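{- Let $V$ be a countable (finite or countably infinite) set. For every $n\in\mathbb{N}$ there exists a natural number $C_1=C_1(n)$ such that $F\left(V,k,\binom{n}{2}\right)$ holds for all $k\geq C_1$.
   Context: For a set $V$ and natural numbers $k,m$, the proposition $F(V,k,m)$ states: for every colouring of the edges of the complete graph on vertex set $V$ using exactly $k$ colours, there is a subset $X\subset V$ such that the edges with both endpoints in $X$ use exactly $m$ distinct colours. (If $V$ is finite and $\binom{|V|}{2}<k$, no such colouring exists and $F(V,k,m)$ holds vacuously.) -}

module Defs where

open import Data.Nat using (ℕ)
open import Data.Fin using (Fin)
open import Data.Fin.Subset using (Subset; _∈_; ∣_∣)
open import Data.Product using (Σ; _×_; ∃; ∃-syntax)
open import Function.Definitions using (Injective)
open import Relation.Binary.PropositionalEquality using (_≡_; _≢_)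
open import Function.Bundles using (_⇔_)

Countable : Set → Set
Countable V = Σ (V → ℕ) λ f → Injective _≡_ _≡_ f

-- An edge colouring of the complete graph on V with colours Fin k:
-- a symmetric colour assignment to pairs (values on the diagonal x = x
-- are irrelevant, as they are never edges).
record Colouring (V : Set) (k : ℕ) : Set where
  field
    col  : V → V → Fin k
    symm : ∀ x y → col x y ≡ col y x

open Colouring public

UsesAll : {V : Set} {k : ℕ} → Colouring V k → Set
UsesAll {V} {k} c = ∀ (i : Fin k) → ∃[ x ] ∃[ y ] (x ≢ y × col c x y ≡ i)

AppearsIn : {V : Set} {k : ℕ} → Colouring V k → (V → Set) → Fin k → Set
AppearsIn c X i = ∃[ x ] ∃[ y ] (X x × X y × x ≢ y × col c x y ≡ i)

ExactlyColours : {V : Set} {k : ℕ} → Colouring V k → (V → Set) → ℕ → Set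
ExactlyColours {k = k} c X m =
  Σ (Subset k) λ S → (∣ S ∣ ≡ m) × (∀ i → (i ∈ S) ⇔ AppearsIn c X i)

F : Set → ℕ → ℕ → Set₁
F V k m = (c : Colouring V k) → UsesAll c → Σ (V → Set) λ X → ExactlyColours c X m

-- Pick one edge of every colour and let W be the set of their endpoints.  If
-- some vertex sees many colours inside W, it is the apex of a large rainbow
-- star, and sifting the leaves as in the canonical Ramsey theorem yields a
-- rainbow K_n, a clique coloured by its older or by its newer endpoints, or a
-- monochromatic clique seen rainbow from the apex; each of these spans exactly
-- T = n C 2 colours once its size is chosen right.  Otherwise all colour
-- degrees in W are bounded, so the k chosen edges contain a long rainbow
-- matching.  Refining it makes the four colours between two of its edges depend
-- only on the older edge; then the same alternatives occur, or the cross
-- colours are constant, and T - c of the edges, where c ≤ 4 is the number of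
-- distinct cross colours, span exactly T colours.

module Submission where

open import Defs
open import Data.Bool using (true; false)
open import Data.Empty using (⊥)
open import Data.Nat using (ℕ; zero; suc; _+_; _*_; _^_; _∸_; _≤_; _<_; _≥_; z≤n; s≤s; _≤?_) renaming (_≟_ to _≟ℕ_)
open import Data.Nat.Properties
open import Data.Nat.Combinatorics using (_C_; nC1≡n; nCk+nC[k+1]≡[n+1]C[k+1])
open import Data.Fin using (Fin; zero; suc; fromℕ<) renaming (_≟_ to _≟ᶠ_)
import Data.Fin.Properties as Fin
open import Data.Fin.Subset using (Subset; inside; outside; ⁅_⁆; _∪_; ⋃)
  renaming (_∈_ to _∈ₛ_; _∉_ to _∉ₛ_; ∣_∣ to ∣_∣ₛ)
open import Data.Fin.Subset.Properties
  using (∉⊥; x∈⁅x⁆; x∈⁅y⁆⇒x≡y; x∈p∪q⁻; x∈p∪q⁺; ∪-identityˡ; ∣⊥∣≡0)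
open import Data.Vec using (_∷_; here; there)
open import Data.List using (List; []; _∷_; _++_; length; filter; map; take; tabulate; concatMap; deduplicate)
open import Data.List.Properties using (length-map; length-++; length-filter; length-take; length-tabulate; length-deduplicate)
open import Data.List.Membership.Propositional using (_∈_; _∉_)
open import Data.List.Membership.Propositional.Properties
  using ( ∈-filter⁺; ∈-map⁺; ∈-map⁻; ∈-++⁺ˡ; ∈-++⁺ʳ; ∈-++⁻; ∈-concatMap⁺
        ; ∈-deduplicate⁺; ∈-deduplicate⁻)
open import Data.List.Relation.Unary.Any as Any using (here; there; any?; satisfied)
import Data.List.Relation.Unary.Any.Properties as Any
open import Data.List.Relation.Unary.All as All using (All; []; _∷_)
open import Data.List.Relation.Unary.All.Properties
  using (all-filter; All¬⇒¬Any; ¬Any⇒All¬) renaming (map⁺ to All-map⁺; tabulate⁺ to All-tabulate⁺)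
open import Data.List.Relation.Unary.AllPairs using (AllPairs; []; _∷_) renaming (head to AllPairs-head)
import Data.List.Relation.Unary.AllPairs.Properties as AllPairs
open import Data.List.Relation.Unary.Unique.Propositional using (Unique)
import Data.List.Relation.Unary.Unique.Propositional.Properties as Unique
open import Data.List.Relation.Unary.Unique.DecPropositional.Properties using (deduplicate-!)
import Data.List.Relation.Unary.Unique.DecSetoid.Properties as DecSetoid
open import Data.List.Relation.Binary.Sublist.Propositional using (_⊆_; []; _∷_; _∷ʳ_; ⊆-refl; ⊆-trans; minimum)
open import Data.List.Relation.Binary.Sublist.Propositional.Properties
  using (All-resp-⊆; Any-resp-⊆; filter-⊆; take-⊆; map⁺; length-mono-≤)
open import Data.Product using (Σ; ∃; _×_; _,_; proj₁; proj₂)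
open import Data.Sum using (_⊎_; inj₁; inj₂)
open import Data.Unit using (⊤; tt)
open import Function using (_on_; _∘_)
open import Function.Bundles using (mk⇔)
open import Level using (0ℓ)
open import Relation.Binary using (Rel; DecidableEquality)
import Relation.Binary.Construct.On as On
open import Relation.Binary.PropositionalEquality
  using (_≡_; _≢_; ≢-sym; refl; sym; trans; cong; cong₂; subst; subst₂; module ≡-Reasoning)
open import Relation.Nullary using (does; yes; no; ¬?; contradiction)
open import Relation.Unary using (Pred; Decidable; ∁)
open import Relation.Unary.Properties using (∁?)

private variable A B : Set

AllPairs-resp-⊆ : ∀ {R : Rel A 0ℓ} {xs ys} → xs ⊆ ys → AllPairs R ys → AllPairs R xs
AllPairs-resp-⊆ [] [] = []
AllPairs-resp-⊆ (y ∷ʳ τ) (_ ∷ rys) = AllPairs-resp-⊆ τ rys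
AllPairs-resp-⊆ (refl ∷ τ) (rx ∷ rys) = All-resp-⊆ τ rx ∷ AllPairs-resp-⊆ τ rys

AllPairs-map-∈ : ∀ {R S : Rel A 0ℓ} {xs} → (∀ {x y} → x ∈ xs → y ∈ xs → R x y → S x y) →
  AllPairs R xs → AllPairs S xs
AllPairs-map-∈ f [] = []
AllPairs-map-∈ f (rx ∷ rxs) =
  All.tabulate (λ y∈ → f (here refl) (there y∈) (All.lookup rx y∈)) ∷
  AllPairs-map-∈ (λ x∈ y∈ → f (there x∈) (there y∈)) rxs

module _ {P : Pred A 0ℓ} (P? : Decidable P) where

  length-filter+filter-∁ : ∀ xs → length (filter P? xs) + length (filter (∁? P?) xs) ≡ length xs
  length-filter+filter-∁ [] = refl
  length-filter+filter-∁ (x ∷ xs) with P? x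
  ... | yes _ = cong suc (length-filter+filter-∁ xs)
  ... | no _ = trans (+-suc _ _) (cong suc (length-filter+filter-∁ xs))

  length-≤-double : ∀ xs {m} → length (filter P? xs) + length (filter (∁? P?) xs) ≤ m + m → length xs ≤ 2 * m
  length-≤-double xs {m} ≤m+m = subst₂ _≤_ (length-filter+filter-∁ xs) (cong (m +_) (sym (+-identityʳ m))) ≤m+m

  larger-part : ∀ xs → ∃ λ ys → ys ⊆ xs × (All P ys ⊎ All (∁ P) ys) × length xs ≤ 2 * length ys
  larger-part xs with length (filter (∁? P?) xs) ≤? length (filter P? xs)
  ... | yes ∁≤ = filter P? xs , filter-⊆ P? xs , inj₁ (all-filter P? xs) ,
    length-≤-double xs {length (filter P? xs)} (+-monoʳ-≤ _ ∁≤)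
  ... | no ∁≰ = filter (∁? P?) xs , filter-⊆ (∁? P?) xs , inj₂ (all-filter (∁? P?) xs) ,
    length-≤-double xs {length (filter (∁? P?) xs)} (+-monoˡ-≤ _ (<⇒≤ (≰⇒> ∁≰)))

length-take-≤ : ∀ m (xs : List A) → m ≤ length xs → length (take m xs) ≡ m
length-take-≤ m xs m≤ = trans (length-take m xs) (m≤n⇒m⊓n≡m m≤)

module _ (_≟_ : DecidableEquality A) where

  Unique-length-≤ : ∀ {xs : List A} ys → Unique xs → (∀ {x} → x ∈ xs → x ∈ ys) → length xs ≤ length ys
  Unique-length-≤ {[]} ys _ _ = z≤n
  Unique-length-≤ {x ∷ xs} ys (x∉xs ∷ uxs) xs⊆ys =
    ≤-trans (s≤s (Unique-length-≤ ys∖x uxs xs⊆ys∖x)) (length-remove (xs⊆ys (here refl)))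
    where
    ys∖x : List A
    ys∖x = filter (λ y → ¬? (y ≟ x)) ys
    xs⊆ys∖x : ∀ {z} → z ∈ xs → z ∈ ys∖x
    xs⊆ys∖x z∈ = ∈-filter⁺ (λ y → ¬? (y ≟ x)) (xs⊆ys (there z∈)) λ { refl → All¬⇒¬Any x∉xs z∈ }
    length-remove : ∀ {zs} → x ∈ zs → length (filter (λ y → ¬? (y ≟ x)) zs) < length zs
    length-remove {z ∷ zs} (here refl) with z ≟ z
    ... | yes _ = s≤s (length-filter (λ y → ¬? (y ≟ x)) zs)
    ... | no z≢z = contradiction refl z≢z
    length-remove {z ∷ zs} (there x∈) with does (¬? (z ≟ x))
    ... | true = s≤s (length-remove x∈)
    ... | false = m≤n⇒m≤1+n (length-remove x∈)

Constant : (A → B) → List A → Set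
Constant f ys = ∃ λ b → All (λ y → f y ≡ b) ys

module _ (_≟_ : DecidableEquality B) (f : A → B) where

  fibre? : ∀ x → Decidable (λ y → f y ≡ f x)
  fibre? x y = f y ≟ f x

  -- if no fibre of f has more than s elements, greedily collect r distinct values
  constant-or-injective : ∀ r s (xs : List A) → r * suc s ≤ length xs →
      (∃ λ ys → ys ⊆ xs × suc s ≤ length ys × Constant f ys)
    ⊎ (∃ λ ys → ys ⊆ xs × length ys ≡ r × AllPairs (_≢_ on f) ys)
  constant-or-injective zero s xs _ = inj₂ ([] , minimum xs , refl , [])
  constant-or-injective (suc r) s (x ∷ xs) big with suc s ≤? length (x ∷ filter (fibre? x) xs)
  ... | yes fibre-big =
    inj₁ (x ∷ filter (fibre? x) xs , refl ∷ filter-⊆ (fibre? x) xs , fibre-big , f x , refl ∷ all-filter (fibre? x) xs)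
  ... | no fibre-small with constant-or-injective r s (filter (∁? (fibre? x)) xs) rest-big
    where
    rest-big : r * suc s ≤ length (filter (∁? (fibre? x)) xs)
    rest-big = +-cancelˡ-≤ s _ _ (begin
      s + r * suc s                                                         ≤⟨ ≤-pred big ⟩
      length xs                                                             ≡⟨ length-filter+filter-∁ (fibre? x) xs ⟨
      length (filter (fibre? x) xs) + length (filter (∁? (fibre? x)) xs)
        ≤⟨ +-monoˡ-≤ _ (<⇒≤ (≤-pred (≰⇒> fibre-small))) ⟩
      s + length (filter (∁? (fibre? x)) xs)                               ∎)
      where open ≤-Reasoning
  ... | inj₁ (ys , ys⊆ , len , const) = inj₁ (ys , x ∷ʳ ⊆-trans ys⊆ (filter-⊆ _ xs) , len , const)
  ... | inj₂ (ys , ys⊆ , len , inj) =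
    inj₂ (x ∷ ys , refl ∷ ⊆-trans ys⊆ (filter-⊆ _ xs) , cong suc len ,
          All.map (λ fy≢fx fx≡fy → fy≢fx (sym fx≡fy)) (All-resp-⊆ ys⊆ (all-filter _ xs)) ∷ inj)

module _ (_≟_ : DecidableEquality B) (f : A → B) (O : List B) where
  open import Data.List.Membership.DecPropositional _≟_ using (_∈?_)

  -- an f-injective list has at most |O| elements with f-value in O
  length-filter-∉ : ∀ xs → AllPairs (_≢_ on f) xs →
    length xs ∸ length O ≤ length (filter (λ x → ¬? (f x ∈? O)) xs)
  length-filter-∉ xs inj = begin
    length xs ∸ length O                          ≤⟨ ∸-monoʳ-≤ (length xs) hits≤ ⟩
    length xs ∸ length hits                       ≡⟨ cong (_∸ length hits) (length-filter+filter-∁ in? xs) ⟨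
    length hits + length (filter (∁? in?) xs) ∸ length hits ≡⟨ m+n∸m≡n (length hits) _ ⟩
    length (filter (∁? in?) xs)                   ∎
    where
    open ≤-Reasoning
    in? : Decidable (λ x → f x ∈ O)
    in? x = f x ∈? O
    hits : List A
    hits = filter in? xs
    hits≤ : length hits ≤ length O
    hits≤ = subst (_≤ length O) (length-map f hits)
      (Unique-length-≤ _≟_ O (AllPairs.map⁺ (AllPairs-resp-⊆ (filter-⊆ in? xs) inj)) hit∈O)
      where
      hit∈O : ∀ {b} → b ∈ map f hits → b ∈ O
      hit∈O b∈ with ∈-map⁻ f b∈
      ... | x , x∈ , refl = All.lookup (all-filter in? xs) x∈

private variable k : ℕ

∣⁅x⁆∪p∣≡1+∣p∣ : ∀ (x : Fin k) p → x ∉ₛ p → ∣ ⁅ x ⁆ ∪ p ∣ₛ ≡ suc ∣ p ∣ₛ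
∣⁅x⁆∪p∣≡1+∣p∣ zero (inside ∷ p) x∉p = contradiction here x∉p
∣⁅x⁆∪p∣≡1+∣p∣ zero (outside ∷ p) _ = cong (λ q → suc ∣ q ∣ₛ) (∪-identityˡ p)
∣⁅x⁆∪p∣≡1+∣p∣ (suc x) (inside ∷ p) x∉p = cong suc (∣⁅x⁆∪p∣≡1+∣p∣ x p (λ x∈p → x∉p (there x∈p)))
∣⁅x⁆∪p∣≡1+∣p∣ (suc x) (outside ∷ p) x∉p = ∣⁅x⁆∪p∣≡1+∣p∣ x p (λ x∈p → x∉p (there x∈p))

fromList : List (Fin k) → Subset k
fromList is = ⋃ (map ⁅_⁆ is)

∈-fromList⁻ : ∀ {i : Fin k} is → i ∈ₛ fromList is → i ∈ is
∈-fromList⁻ [] i∈ = contradiction i∈ ∉⊥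
∈-fromList⁻ (j ∷ is) i∈ with x∈p∪q⁻ ⁅ j ⁆ (fromList is) i∈
... | inj₁ i∈⁅j⁆ = here (x∈⁅y⁆⇒x≡y j i∈⁅j⁆)
... | inj₂ i∈is = there (∈-fromList⁻ is i∈is)

∈-fromList⁺ : ∀ {i : Fin k} {is} → i ∈ is → i ∈ₛ fromList is
∈-fromList⁺ {i = i} (here refl) = x∈p∪q⁺ (inj₁ (x∈⁅x⁆ i))
∈-fromList⁺ (there i∈) = x∈p∪q⁺ (inj₂ (∈-fromList⁺ i∈))

∣fromList∣ : (is : List (Fin k)) → Unique is → ∣ fromList is ∣ₛ ≡ length is
∣fromList∣ {k} [] _ = ∣⊥∣≡0 k
∣fromList∣ (j ∷ is) (j∉is ∷ u) =
  trans (∣⁅x⁆∪p∣≡1+∣p∣ j (fromList is) (λ j∈ → All¬⇒¬Any j∉is (∈-fromList⁻ is j∈)))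
        (cong suc (∣fromList∣ is u))

module _ {V : Set} (c : Colouring V k) (X : V → Set) where

  ExactlyColours-fromList : (cs : List (Fin k)) → Unique cs →
    (∀ {i} → AppearsIn c X i → i ∈ cs) → (∀ {i} → i ∈ cs → AppearsIn c X i) →
    ExactlyColours c X (length cs)
  ExactlyColours-fromList cs u sound complete =
    fromList cs , ∣fromList∣ cs u ,
    λ i → mk⇔ (λ i∈ → complete (∈-fromList⁻ cs i∈)) (λ app → ∈-fromList⁺ (sound app))

-- Vertex sets spanning an exact number of colours

module Configurations {V : Set} {k : ℕ} (c : Colouring V k) where

  open import Data.List.Membership.DecPropositional (_≟ᶠ_ {k}) using (_∈?_)

  κ : V → V → Fin k
  κ = col c

  SpansExactly : ℕ → Set₁
  SpansExactly m = Σ (V → Set) λ X → ExactlyColours c X m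

  appears : ∀ {xs x y} → x ∈ xs → y ∈ xs → x ≢ y → AppearsIn c (_∈ xs) (κ x y)
  appears {x = x} {y} x∈ y∈ x≢y = x , y , x∈ , y∈ , x≢y , refl

  appears-mono : ∀ {xs ys} → (∀ {x} → x ∈ xs → x ∈ ys) → ∀ {i} → AppearsIn c (_∈ xs) i → AppearsIn c (_∈ ys) i
  appears-mono f (x , y , x∈ , y∈ , x≢y , e) = x , y , f x∈ , f y∈ , x≢y , e

  exactly : ∀ (xs : List V) (cs : List (Fin k)) {m} → length cs ≡ m → Unique cs →
    (∀ {x y} → x ∈ xs → y ∈ xs → x ≢ y → κ x y ∈ cs) →
    (∀ {i} → i ∈ cs → AppearsIn c (_∈ xs) i) →
    ExactlyColours c (_∈ xs) m
  exactly xs cs refl u sound complete =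
    ExactlyColours-fromList c (_∈ xs) cs u (λ { (x , y , x∈ , y∈ , x≢y , refl) → sound x∈ y∈ x≢y }) complete

  spans : ∀ {xs : List V} {m m'} → m ≡ m' → ExactlyColours c (_∈ xs) m → SpansExactly m'
  spans {xs} refl ex = (_∈ xs) , ex

  monochromatic+rainbow-apex : ∀ (z : V) (S : List V) (γ : Fin k) →
    z ∉ S → Unique S → AllPairs (_≢_ on κ z) S →
    (∀ {x y} → x ∈ S → y ∈ S → x ≢ y → κ x y ≡ γ) →
    All (λ s → κ z s ≢ γ) S → 2 ≤ length S →
    ExactlyColours c (_∈ z ∷ S) (suc (length S))
  monochromatic+rainbow-apex z S γ z∉S uS inj mono avoidγ two =
    exactly (z ∷ S) (γ ∷ map (κ z) S) (cong suc (length-map (κ z) S))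
      (¬Any⇒All¬ _ γ∉ ∷ AllPairs.map⁺ inj) sound complete
    where
    γ∉ : γ ∉ map (κ z) S
    γ∉ γ∈ with ∈-map⁻ (κ z) γ∈
    ... | s , s∈ , γ≡ = All.lookup avoidγ s∈ (sym γ≡)
    sound : ∀ {x y} → x ∈ z ∷ S → y ∈ z ∷ S → x ≢ y → κ x y ∈ γ ∷ map (κ z) S
    sound (here refl) (here refl) x≢y = contradiction refl x≢y
    sound (here refl) (there y∈) _ = there (∈-map⁺ (κ z) y∈)
    sound {x} (there x∈) (here refl) _ = there (subst (_∈ map (κ z) S) (symm c z x) (∈-map⁺ (κ z) x∈))
    sound (there x∈) (there y∈) x≢y = here (mono x∈ y∈ x≢y)
    γ-appears : ∀ T → Unique T → 2 ≤ length T → (∀ {x y} → x ∈ T → y ∈ T → x ≢ y → κ x y ≡ γ) →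
      AppearsIn c (_∈ z ∷ T) γ
    γ-appears (s₁ ∷ s₂ ∷ _) ((s₁≢s₂ ∷ _) ∷ _) _ mono' =
      subst (AppearsIn c (_∈ z ∷ s₁ ∷ s₂ ∷ _)) (mono' (here refl) (there (here refl)) s₁≢s₂)
        (appears (there (here refl)) (there (there (here refl))) s₁≢s₂)
    γ-appears (_ ∷ []) _ (s≤s ()) _
    complete : ∀ {i} → i ∈ γ ∷ map (κ z) S → AppearsIn c (_∈ z ∷ S) i
    complete (here refl) = γ-appears S uS two mono
    complete (there i∈) with ∈-map⁻ (κ z) i∈
    ... | s , s∈ , refl = appears (here refl) (there s∈) λ { refl → z∉S s∈ }

  Labelled : Set
  Labelled = V × Fin k

  vertices : List Labelled → List V
  vertices = map proj₁

  labels : List Labelled → List (Fin k)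
  labels = map proj₂

  -- Lists grow at the head, so later entries are older; an older entry (x , γ)
  -- is joined to every newer vertex in colour γ (a "min-coloured" sequence).
  MinLex : List Labelled → Set
  MinLex [] = ⊤
  MinLex ((v , _) ∷ Ls) = MinLex Ls × v ∉ vertices Ls × All (λ (x , γ) → κ x v ≡ γ) Ls

  MinLex-resp-⊆ : ∀ {Ls Ks} → Ls ⊆ Ks → MinLex Ks → MinLex Ls
  MinLex-resp-⊆ [] _ = tt
  MinLex-resp-⊆ (_ ∷ʳ τ) (ml , _) = MinLex-resp-⊆ τ ml
  MinLex-resp-⊆ (refl ∷ τ) (ml , v∉ , cols) =
    MinLex-resp-⊆ τ ml , (λ v∈ → v∉ (Any-resp-⊆ (map⁺ proj₁ τ) v∈)) , All-resp-⊆ τ cols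

  MinLex-unique : ∀ Ls → MinLex Ls → Unique (vertices Ls)
  MinLex-unique [] _ = []
  MinLex-unique (_ ∷ Ls) (ml , v∉ , _) = ¬Any⇒All¬ _ v∉ ∷ MinLex-unique Ls ml

  MinLex-colour∈labels : ∀ e Ls → MinLex (e ∷ Ls) → ∀ {x y} → x ∈ vertices (e ∷ Ls) → y ∈ vertices (e ∷ Ls) →
    x ≢ y → κ x y ∈ labels Ls
  MinLex-colour∈labels e Ls _ (here refl) (here refl) x≢y = contradiction refl x≢y
  MinLex-colour∈labels (v , _) Ls (_ , _ , cols) (here refl) (there y∈) _ with ∈-map⁻ proj₁ y∈
  ... | (y , γ) , e∈ , refl = subst (_∈ labels Ls) (trans (sym (All.lookup cols e∈)) (symm c y v)) (∈-map⁺ proj₂ e∈)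
  MinLex-colour∈labels (v , _) Ls (_ , _ , cols) (there x∈) (here refl) _ with ∈-map⁻ proj₁ x∈
  ... | (x , γ) , e∈ , refl = subst (_∈ labels Ls) (sym (All.lookup cols e∈)) (∈-map⁺ proj₂ e∈)
  MinLex-colour∈labels _ (e ∷ Ls) (ml , _) (there x∈) (there y∈) x≢y = there (MinLex-colour∈labels e Ls ml x∈ y∈ x≢y)

  minLex-exactly : ∀ e Ls → MinLex (e ∷ Ls) → AllPairs (_≢_ on proj₂) Ls →
    ExactlyColours c (_∈ vertices (e ∷ Ls)) (length Ls)
  minLex-exactly (v , γ) Ls ml@(_ , v∉ , cols) distinct =
    exactly (vertices ((v , γ) ∷ Ls)) (labels Ls) (length-map proj₂ Ls) (AllPairs.map⁺ distinct)
      (MinLex-colour∈labels (v , γ) Ls ml) complete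
    where
    complete : ∀ {i} → i ∈ labels Ls → AppearsIn c (_∈ vertices ((v , γ) ∷ Ls)) i
    complete i∈ with ∈-map⁻ proj₂ i∈
    ... | (x , γx) , e∈ , refl =
      subst (AppearsIn c (_∈ vertices ((v , γ) ∷ Ls))) (All.lookup cols e∈)
        (appears (there (∈-map⁺ proj₁ e∈)) (here refl) λ { refl → v∉ (∈-map⁺ proj₁ e∈) })

  MinLex-monochromatic : ∀ Ls b → MinLex Ls → All (λ e → proj₂ e ≡ b) Ls →
    ∀ {x y} → x ∈ vertices Ls → y ∈ vertices Ls → x ≢ y → κ x y ≡ b
  MinLex-monochromatic (e ∷ Ls) b ml (_ ∷ const) x∈ y∈ x≢y
    with ∈-map⁻ proj₂ (MinLex-colour∈labels e Ls ml x∈ y∈ x≢y)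
  ... | _ , e∈ , κ≡ = trans κ≡ (All.lookup const e∈)

  -- discard the at most one vertex seen from z in colour b, and keep m of the rest
  minLex-constant+rainbow-apex : ∀ (z : V) (Ls : List Labelled) (b : Fin k) (m : ℕ) → MinLex Ls →
    All (λ e → proj₂ e ≡ b) Ls → z ∉ vertices Ls → AllPairs (_≢_ on κ z) (vertices Ls) →
    suc m ≤ length Ls → 2 ≤ m → SpansExactly (suc m)
  minLex-constant+rainbow-apex z Ls b m ml const z∉ inj len two =
    spans (cong suc |S|≡m)
      (monochromatic+rainbow-apex z S b (λ z∈ → z∉ (Any-resp-⊆ S⊆ z∈)) (AllPairs-resp-⊆ S⊆ (MinLex-unique Ls ml))
        (AllPairs-resp-⊆ S⊆ inj)
        (λ x∈ y∈ → MinLex-monochromatic Ls b ml const (Any-resp-⊆ S⊆ x∈) (Any-resp-⊆ S⊆ y∈))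
        avoid-b (≤-trans two (≤-reflexive (sym |S|≡m))))
    where
    not-b? : Decidable (λ a → κ z a ∉ b ∷ [])
    not-b? a = ¬? (κ z a ∈? (b ∷ []))
    S₁ S : List V
    S₁ = filter not-b? (vertices Ls)
    S = take m S₁
    S⊆ : S ⊆ vertices Ls
    S⊆ = ⊆-trans (take-⊆ m S₁) (filter-⊆ not-b? (vertices Ls))
    m≤|S₁| : m ≤ length S₁
    m≤|S₁| = ≤-trans (∸-monoˡ-≤ 1 (≤-trans len (≤-reflexive (sym (length-map proj₁ Ls)))))
               (length-filter-∉ _≟ᶠ_ (κ z) (b ∷ []) (vertices Ls) inj)
    |S|≡m : length S ≡ m
    |S|≡m = length-take-≤ m S₁ m≤|S₁|
    avoid-b : All (λ s → κ z s ≢ b) S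
    avoid-b = All.map (λ ∉b ≡b → ∉b (here ≡b)) (All-resp-⊆ (take-⊆ m S₁) (all-filter not-b? (vertices Ls)))

  pairColours : List V → List (Fin k)
  pairColours [] = []
  pairColours (v ∷ Q) = map (κ v) Q ++ pairColours Q

  length-pairColours : ∀ Q → length (pairColours Q) ≡ length Q C 2
  length-pairColours [] = refl
  length-pairColours (v ∷ Q) = begin
    length (map (κ v) Q ++ pairColours Q)          ≡⟨ length-++ (map (κ v) Q) ⟩
    length (map (κ v) Q) + length (pairColours Q)  ≡⟨ cong₂ _+_ (length-map (κ v) Q) (length-pairColours Q) ⟩
    length Q + length Q C 2                        ≡⟨ cong (_+ length Q C 2) (nC1≡n (length Q)) ⟨
    length Q C 1 + length Q C 2                    ≡⟨ nCk+nC[k+1]≡[n+1]C[k+1] (length Q) 1 ⟩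
    suc (length Q) C 2                             ∎
    where open ≡-Reasoning

  length-pairColours-≤ : ∀ Q → length (pairColours Q) ≤ length Q * length Q
  length-pairColours-≤ [] = z≤n
  length-pairColours-≤ (v ∷ Q) = begin
    length (map (κ v) Q ++ pairColours Q)         ≡⟨ trans (length-++ (map (κ v) Q)) (cong (_+ _) (length-map (κ v) Q)) ⟩
    length Q + length (pairColours Q)             ≤⟨ +-monoʳ-≤ (length Q) (length-pairColours-≤ Q) ⟩
    length Q + length Q * length Q                ≤⟨ +-monoʳ-≤ (length Q) (*-monoʳ-≤ (length Q) (n≤1+n _)) ⟩
    length Q + length Q * suc (length Q)          ≤⟨ n≤1+n _ ⟩
    suc (length Q) * suc (length Q)               ∎
    where open ≤-Reasoning

  pairColours-resp-⊆ : ∀ {Y Q} → Y ⊆ Q → ∀ {i} → i ∈ pairColours Y → i ∈ pairColours Q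
  pairColours-resp-⊆ [] i∈ = i∈
  pairColours-resp-⊆ {v ∷ Y} (refl ∷ τ) i∈ with ∈-++⁻ (map (κ v) Y) i∈
  ... | inj₁ i∈′ = ∈-++⁺ˡ (Any-resp-⊆ (map⁺ (κ v) τ) i∈′)
  ... | inj₂ i∈′ = ∈-++⁺ʳ _ (pairColours-resp-⊆ τ i∈′)
  pairColours-resp-⊆ (y ∷ʳ τ) i∈ = ∈-++⁺ʳ (map (κ y) _) (pairColours-resp-⊆ τ i∈)

  colour∈pairColours : ∀ Y {x y} → x ∈ Y → y ∈ Y → x ≢ y → κ x y ∈ pairColours Y
  colour∈pairColours (v ∷ Y) (here refl) (here refl) x≢y = contradiction refl x≢y
  colour∈pairColours (v ∷ Y) (here refl) (there y∈) _ = ∈-++⁺ˡ (∈-map⁺ (κ v) y∈)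
  colour∈pairColours (v ∷ Y) {x} (there x∈) (here refl) _ =
    ∈-++⁺ˡ (subst (_∈ map (κ v) Y) (symm c v x) (∈-map⁺ (κ v) x∈))
  colour∈pairColours (v ∷ Y) (there x∈) (there y∈) x≢y = ∈-++⁺ʳ (map (κ v) Y) (colour∈pairColours Y x∈ y∈ x≢y)

  pairColours-appear : ∀ Y → Unique Y → ∀ {i} → i ∈ pairColours Y → AppearsIn c (_∈ Y) i
  pairColours-appear (v ∷ Y) (v∉ ∷ u) i∈ with ∈-++⁻ (map (κ v) Y) i∈
  ... | inj₂ i∈′ = appears-mono there (pairColours-appear Y u i∈′)
  ... | inj₁ i∈′ with ∈-map⁻ (κ v) i∈′
  ...   | y , y∈ , refl = appears (here refl) (there y∈) λ { refl → All¬⇒¬Any v∉ y∈ }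

  Refines : List V → V → V → Set
  Refines Q u w = ∀ {a b} → a ∈ Q → b ∈ Q → κ a u ≡ κ b u → κ a w ≡ κ b w

  -- A vertex added to a spine brings only colours new to the older part, and
  -- splits the older part by colour exactly as w does.
  Spine : V → List V → Set
  Spine w [] = ⊤
  Spine w (v ∷ Q) = Spine w Q × v ∉ Q × (∀ {a} → a ∈ Q → κ a v ∉ pairColours Q) × Refines Q v w × Refines Q w v

  Spine-resp-⊆ : ∀ {w Y Q} → Y ⊆ Q → Spine w Q → Spine w Y
  Spine-resp-⊆ [] _ = tt
  Spine-resp-⊆ (_ ∷ʳ τ) (sp , _) = Spine-resp-⊆ τ sp
  Spine-resp-⊆ (refl ∷ τ) (sp , v∉ , fresh , v⇒w , w⇒v) =
    Spine-resp-⊆ τ sp , (λ v∈ → v∉ (Any-resp-⊆ τ v∈)) ,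
    (λ a∈ i∈ → fresh (Any-resp-⊆ τ a∈) (pairColours-resp-⊆ τ i∈)) ,
    (λ a∈ b∈ → v⇒w (Any-resp-⊆ τ a∈) (Any-resp-⊆ τ b∈)) ,
    (λ a∈ b∈ → w⇒v (Any-resp-⊆ τ a∈) (Any-resp-⊆ τ b∈))

  Spine-unique : ∀ {w} Y → Spine w Y → Unique Y
  Spine-unique [] _ = []
  Spine-unique (_ ∷ Y) (sp , v∉ , _) = ¬Any⇒All¬ _ v∉ ∷ Spine-unique Y sp

  spine-rainbow : ∀ w Y → Spine w Y → AllPairs (_≢_ on (λ a → κ a w)) Y →
    ExactlyColours c (_∈ Y) (length Y C 2)
  spine-rainbow w Y sp inj =
    exactly Y (pairColours Y) (length-pairColours Y) (distinct Y sp inj) (colour∈pairColours Y)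
      (pairColours-appear Y (Spine-unique Y sp))
    where
    distinct : ∀ Y → Spine w Y → AllPairs (_≢_ on (λ a → κ a w)) Y → Unique (pairColours Y)
    distinct [] _ _ = []
    distinct (v ∷ Y) (sp , _ , fresh , v⇒w , _) (_ ∷ inj) =
      Unique.++⁺ (AllPairs.map⁺ inj-v) (distinct Y sp inj) disjoint
      where
      inj-v : AllPairs (_≢_ on κ v) Y
      inj-v = AllPairs-map-∈ (λ {a} {b} a∈ b∈ κa≢κb κv≡ →
        κa≢κb (v⇒w a∈ b∈ (trans (symm c a v) (trans κv≡ (symm c v b))))) inj
      disjoint : ∀ {i} → i ∈ map (κ v) Y × i ∈ pairColours Y → ⊥
      disjoint (i∈ , i∈′) with ∈-map⁻ (κ v) i∈
      ... | y , y∈ , refl = fresh y∈ (subst (_∈ pairColours Y) (symm c v y) i∈′)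

  consecutiveColours : List V → List (Fin k)
  consecutiveColours [] = []
  consecutiveColours (v ∷ []) = []
  consecutiveColours (v ∷ y ∷ Y) = κ v y ∷ consecutiveColours (y ∷ Y)

  length-consecutiveColours : ∀ v Y → length (consecutiveColours (v ∷ Y)) ≡ length Y
  length-consecutiveColours v [] = refl
  length-consecutiveColours v (y ∷ Y) = cong suc (length-consecutiveColours y Y)

  consecutiveColours⊆pairColours : ∀ v Y {i} → i ∈ consecutiveColours (v ∷ Y) → i ∈ pairColours (v ∷ Y)
  consecutiveColours⊆pairColours v (y ∷ Y) (here refl) = here refl
  consecutiveColours⊆pairColours v (y ∷ Y) (there i∈) =
    ∈-++⁺ʳ (map (κ v) (y ∷ Y)) (consecutiveColours⊆pairColours y Y i∈)

  -- When the spine sees w in a single colour, each vertex is joined to all older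
  -- ones in one colour, which is fresh: a max-coloured clique.
  spine-maxLex : ∀ w γ v Y → Spine w (v ∷ Y) → All (λ a → κ a w ≡ γ) (v ∷ Y) →
    ExactlyColours c (_∈ v ∷ Y) (length Y)
  spine-maxLex w γ v Y sp const =
    exactly (v ∷ Y) (consecutiveColours (v ∷ Y)) (length-consecutiveColours v Y) (distinct v Y sp) (sound v Y sp const)
      (complete v Y sp)
    where
    colour-to-older : ∀ v y Y → Spine w (v ∷ y ∷ Y) → All (λ a → κ a w ≡ γ) (v ∷ y ∷ Y) →
      ∀ {z} → z ∈ y ∷ Y → κ z v ≡ κ y v
    colour-to-older v y Y (_ , _ , _ , _ , w⇒v) (_ ∷ const) z∈ =
      w⇒v z∈ (here refl) (trans (All.lookup const z∈) (sym (All.lookup const (here refl))))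
    sound : ∀ v Y → Spine w (v ∷ Y) → All (λ a → κ a w ≡ γ) (v ∷ Y) →
      ∀ {x y} → x ∈ v ∷ Y → y ∈ v ∷ Y → x ≢ y → κ x y ∈ consecutiveColours (v ∷ Y)
    sound v Y _ _ (here refl) (here refl) x≢y = contradiction refl x≢y
    sound v (y ∷ Y) sp const {_} {z} (here refl) (there z∈) _ =
      here (trans (symm c v z) (trans (colour-to-older v y Y sp const z∈) (symm c y v)))
    sound v (y ∷ Y) sp const (there z∈) (here refl) _ =
      here (trans (colour-to-older v y Y sp const z∈) (symm c y v))
    sound v (y ∷ Y) (sp , _) (_ ∷ const) (there x∈) (there y∈) x≢y = there (sound y Y sp const x∈ y∈ x≢y)
    distinct : ∀ v Y → Spine w (v ∷ Y) → Unique (consecutiveColours (v ∷ Y))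
    distinct v [] _ = []
    distinct v (y ∷ Y) (sp , _ , fresh , _) =
      ¬Any⇒All¬ _ (λ i∈ → fresh (here refl)
        (subst (_∈ pairColours (y ∷ Y)) (symm c v y) (consecutiveColours⊆pairColours y Y i∈)))
      ∷ distinct y Y sp
    complete : ∀ v Y → Spine w (v ∷ Y) → ∀ {i} → i ∈ consecutiveColours (v ∷ Y) → AppearsIn c (_∈ v ∷ Y) i
    complete v (y ∷ Y) (_ , v∉ , _) (here refl) = appears (here refl) (there (here refl)) λ { refl → v∉ (here refl) }
    complete v (y ∷ Y) (sp , _) (there i∈) = appears-mono there (complete y Y sp i∈)

  Edge : Set
  Edge = V × V

  colourOf : Edge → Fin k
  colourOf (p , q) = κ p q

  ends : Edge → List V
  ends (p , q) = p ∷ q ∷ []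

  ends-colour : ∀ e {x y} → x ∈ ends e → y ∈ ends e → x ≢ y → κ x y ≡ colourOf e
  ends-colour e (here refl) (here refl) x≢y = contradiction refl x≢y
  ends-colour e (here refl) (there (here refl)) _ = refl
  ends-colour (p , q) (there (here refl)) (here refl) _ = symm c q p
  ends-colour e (there (here refl)) (there (here refl)) x≢y = contradiction refl x≢y

  no-edge : ExactlyColours c (_∈ []) 0
  no-edge = exactly [] [] refl [] (λ ()) (λ ())

  single-edge : ∀ {x y} → x ≢ y → ExactlyColours c (_∈ x ∷ y ∷ []) 1
  single-edge {x} {y} x≢y = exactly (x ∷ y ∷ []) (κ x y ∷ []) refl ([] ∷ [])
    (λ u∈ v∈ u≢v → here (ends-colour (x , y) u∈ v∈ u≢v))
    λ { (here refl) → appears (here refl) (there (here refl)) x≢y }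

  Separated : Edge → Edge → Set
  Separated e e′ = (∀ {x} → x ∈ ends e → x ∉ ends e′) × colourOf e ≢ colourOf e′

  separated-≢ : ∀ {e e′ x y} → Separated e e′ → x ∈ ends e → y ∈ ends e′ → x ≢ y
  separated-≢ (disj , _) x∈ y∈ refl = disj x∈ y∈

  CrossTags : Set
  CrossTags = Fin k × Fin k × Fin k × Fin k

  tagList : CrossTags → List (Fin k)
  tagList (z₁ , z₂ , z₃ , z₄) = z₁ ∷ z₂ ∷ z₃ ∷ z₄ ∷ []

  CrossColours : Edge → Edge → CrossTags → Set
  CrossColours (p , q) (p′ , q′) (z₁ , z₂ , z₃ , z₄) = κ p p′ ≡ z₁ × κ p q′ ≡ z₂ × κ q p′ ≡ z₃ × κ q q′ ≡ z₄

  CrossColours-∈ : ∀ e e′ t → CrossColours e e′ t → ∀ {x y} → x ∈ ends e → y ∈ ends e′ → κ x y ∈ tagList t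
  CrossColours-∈ _ _ _ (refl , _ , _ , _) (here refl) (here refl) = here refl
  CrossColours-∈ _ _ _ (_ , refl , _ , _) (here refl) (there (here refl)) = there (here refl)
  CrossColours-∈ _ _ _ (_ , _ , refl , _) (there (here refl)) (here refl) = there (there (here refl))
  CrossColours-∈ _ _ _ (_ , _ , _ , refl) (there (here refl)) (there (here refl)) = there (there (there (here refl)))

  CrossColours-∈⁻ : ∀ e e′ t → CrossColours e e′ t → ∀ {i} → i ∈ tagList t →
    Σ V λ x → Σ V λ y → x ∈ ends e × y ∈ ends e′ × κ x y ≡ i
  CrossColours-∈⁻ _ _ _ (x₁ , _ , _ , _) (here refl) = _ , _ , here refl , here refl , x₁
  CrossColours-∈⁻ _ _ _ (_ , x₂ , _ , _) (there (here refl)) = _ , _ , here refl , there (here refl) , x₂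
  CrossColours-∈⁻ _ _ _ (_ , _ , x₃ , _) (there (there (here refl))) = _ , _ , there (here refl) , here refl , x₃
  CrossColours-∈⁻ _ _ _ (_ , _ , _ , x₄) (there (there (there (here refl)))) = _ , _ , there (here refl) , there (here refl) , x₄

  tagList-constant : ∀ {α ζ δ β} → α ≡ ζ → α ≡ δ → α ≡ β → ∀ {i} → i ∈ tagList (α , ζ , δ , β) → i ∈ α ∷ []
  tagList-constant _ _ _ (here refl) = here refl
  tagList-constant α≡ζ _ _ (there (here refl)) = here (sym α≡ζ)
  tagList-constant _ α≡δ _ (there (there (here refl))) = here (sym α≡δ)
  tagList-constant _ _ α≡β (there (there (there (here refl)))) = here (sym α≡β)

  TaggedEdge : Set
  TaggedEdge = Edge × CrossTags

  -- Newest edge first; every older edge is separated from each newer one, and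
  -- its tags are its cross colours towards it.
  TaggedMatching : List TaggedEdge → Set
  TaggedMatching [] = ⊤
  TaggedMatching ((e , _) ∷ Es) =
    TaggedMatching Es × proj₁ e ≢ proj₂ e ×
    All (λ a → Separated (proj₁ a) e) Es × All (λ (e′ , t) → CrossColours e′ e t) Es

  TaggedMatching-resp-⊆ : ∀ {Ys Es} → Ys ⊆ Es → TaggedMatching Es → TaggedMatching Ys
  TaggedMatching-resp-⊆ [] _ = tt
  TaggedMatching-resp-⊆ (_ ∷ʳ τ) (tm , _) = TaggedMatching-resp-⊆ τ tm
  TaggedMatching-resp-⊆ (refl ∷ τ) (tm , p≢q , sep , cross) =
    TaggedMatching-resp-⊆ τ tm , p≢q , All-resp-⊆ τ sep , All-resp-⊆ τ cross

  edgeColour : TaggedEdge → Fin k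
  edgeColour a = colourOf (proj₁ a)

  TaggedMatching-colours : ∀ Es → TaggedMatching Es → AllPairs (_≢_ on edgeColour) Es
  TaggedMatching-colours [] _ = []
  TaggedMatching-colours (_ ∷ Es) (tm , _ , sep , _) =
    All.map (λ s ≡col → proj₂ s (sym ≡col)) sep ∷ TaggedMatching-colours Es tm

  pEnd qEnd : TaggedEdge → V
  pEnd a = proj₁ (proj₁ a)
  qEnd a = proj₂ (proj₁ a)

  z₁ z₂ : TaggedEdge → Fin k
  z₁ a = proj₁ (proj₂ a)
  z₂ a = proj₁ (proj₂ (proj₂ a))

  flip : TaggedEdge → TaggedEdge
  flip ((p , q) , (t₁ , t₂ , t₃ , t₄)) = (q , p) , (t₄ , t₃ , t₂ , t₁)

  TaggedMatching-flip : ∀ Es → TaggedMatching Es → TaggedMatching (map flip Es)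
  TaggedMatching-flip [] _ = tt
  TaggedMatching-flip (((p , q) , _) ∷ Es) (tm , p≢q , sep , cross) =
    TaggedMatching-flip Es tm , (λ q≡p → p≢q (sym q≡p)) , flip-separated sep , flip-cross cross
    where
    swap : ∀ {x p q} → x ∈ ends (q , p) → x ∈ ends (p , q)
    swap (here refl) = there (here refl)
    swap (there (here refl)) = here refl
    flip-separated : ∀ {L} → All (λ a → Separated (proj₁ a) (p , q)) L →
      All (λ a → Separated (proj₁ a) (q , p)) (map flip L)
    flip-separated [] = []
    flip-separated {((p′ , q′) , _) ∷ _} ((disj , col≢) ∷ seps) =
      ((λ x∈ x∈′ → disj (swap x∈) (swap x∈′)) , (λ ≡col → col≢ (trans (symm c p′ q′) (trans ≡col (symm c q p)))))
      ∷ flip-separated seps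
    flip-cross : ∀ {L} → All (λ (e′ , t) → CrossColours e′ (p , q) t) L →
      All (λ (e′ , t) → CrossColours e′ (q , p) t) (map flip L)
    flip-cross [] = []
    flip-cross ((x₁ , x₂ , x₃ , x₄) ∷ xs) = (x₄ , x₃ , x₂ , x₁) ∷ flip-cross xs

  pLabelled : List TaggedEdge → List Labelled
  pLabelled = map (λ a → pEnd a , z₁ a)

  MinLex-pLabelled : ∀ Es → TaggedMatching Es → MinLex (pLabelled Es)
  MinLex-pLabelled [] _ = tt
  MinLex-pLabelled (e ∷ Es) (tm , _ , sep , cross) = MinLex-pLabelled Es tm , p∉ sep , cols cross
    where
    p∉ : ∀ {L} → All (λ a → Separated (proj₁ a) (proj₁ e)) L → pEnd e ∉ vertices (pLabelled L)
    p∉ (s ∷ _) (here p≡) = proj₁ s (here refl) (here (sym p≡))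
    p∉ (_ ∷ seps) (there p∈) = p∉ seps p∈
    cols : ∀ {L} → All (λ (e′ , t) → CrossColours e′ (proj₁ e) t) L →
      All (λ (x , γ) → κ x (pEnd e) ≡ γ) (pLabelled L)
    cols [] = []
    cols (x ∷ xs) = proj₁ x ∷ cols xs

  endpoints : List TaggedEdge → List V
  endpoints [] = []
  endpoints (a ∷ Es) = ends (proj₁ a) ++ endpoints Es

  ∈-endpoints⁻ : ∀ Es {x} → x ∈ endpoints Es → Σ TaggedEdge λ a → a ∈ Es × x ∈ ends (proj₁ a)
  ∈-endpoints⁻ (a ∷ Es) x∈ with ∈-++⁻ (ends (proj₁ a)) x∈
  ... | inj₁ x∈a = a , here refl , x∈a
  ... | inj₂ x∈Es with ∈-endpoints⁻ Es x∈Es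
  ...   | b , b∈ , x∈b = b , there b∈ , x∈b

  older-cross∈ : ∀ e Es t → All (λ (e′ , t′) → CrossColours e′ e t′) Es → All (λ b → proj₂ b ≡ t) Es →
    ∀ {x y} → x ∈ endpoints Es → y ∈ ends e → κ x y ∈ tagList t
  older-cross∈ e Es t cross const x∈ y∈ with ∈-endpoints⁻ Es x∈
  ... | b , b∈ , x∈b with All.lookup const b∈
  ...   | refl = CrossColours-∈ (proj₁ b) e _ (All.lookup cross b∈) x∈b y∈

  TaggedMatching-colour : ∀ Es t → TaggedMatching Es → All (λ a → proj₂ a ≡ t) Es →
    ∀ {x y} → x ∈ endpoints Es → y ∈ endpoints Es → x ≢ y → κ x y ∈ map edgeColour Es ⊎ κ x y ∈ tagList t
  TaggedMatching-colour (a ∷ Es) t (tm , _ , _ , cross) (_ ∷ const) {x} {y} x∈ y∈ x≢y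
    with ∈-++⁻ (ends (proj₁ a)) x∈ | ∈-++⁻ (ends (proj₁ a)) y∈
  ... | inj₁ x∈a | inj₁ y∈a = inj₁ (here (ends-colour (proj₁ a) x∈a y∈a x≢y))
  ... | inj₁ x∈a | inj₂ y∈Es =
    inj₂ (subst (_∈ tagList t) (symm c y x) (older-cross∈ (proj₁ a) Es t cross const y∈Es x∈a))
  ... | inj₂ x∈Es | inj₁ y∈a = inj₂ (older-cross∈ (proj₁ a) Es t cross const x∈Es y∈a)
  ... | inj₂ x∈Es | inj₂ y∈Es with TaggedMatching-colour Es t tm const x∈Es y∈Es x≢y
  ...   | inj₁ i∈ = inj₁ (there i∈)
  ...   | inj₂ i∈ = inj₂ i∈

  edgeColour-appears : ∀ Es → TaggedMatching Es → ∀ {a} → a ∈ Es → AppearsIn c (_∈ endpoints Es) (edgeColour a)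
  edgeColour-appears (_ ∷ _) (_ , p≢q , _) (here refl) = appears (here refl) (there (here refl)) p≢q
  edgeColour-appears (b ∷ Es) (tm , _) (there a∈) = appears-mono (∈-++⁺ʳ (ends (proj₁ b))) (edgeColour-appears Es tm a∈)

  crossTag-appears : ∀ a b Es → TaggedMatching (a ∷ b ∷ Es) → ∀ {i} → i ∈ tagList (proj₂ b) →
    AppearsIn c (_∈ endpoints (a ∷ b ∷ Es)) i
  crossTag-appears a b Es (_ , _ , (disj , _) ∷ _ , cross ∷ _) i∈ with CrossColours-∈⁻ (proj₁ b) (proj₁ a) _ cross i∈
  ... | x , y , x∈ , y∈ , refl =
    appears (∈-++⁺ʳ (ends (proj₁ a)) (∈-++⁺ˡ x∈)) (∈-++⁺ˡ y∈) λ { refl → disj x∈ y∈ }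

  -- The edge colours are distinct and avoid the cross colours, which are the
  -- same between any two edges; two edges suffice to exhibit every cross colour.
  matching-exactly : ∀ Es t Zs → TaggedMatching Es → All (λ a → proj₂ a ≡ t) Es → Unique Zs →
    (∀ {i} → i ∈ tagList t → i ∈ Zs) → (∀ {i} → i ∈ Zs → i ∈ tagList t) →
    All (λ a → edgeColour a ∉ Zs) Es → 2 ≤ length Es →
    ExactlyColours c (_∈ endpoints Es) (length Es + length Zs)
  matching-exactly Es t Zs tm const uZ tags⊆Zs Zs⊆tags avoid two =
    exactly (endpoints Es) (map edgeColour Es ++ Zs)
      (trans (length-++ (map edgeColour Es)) (cong (_+ length Zs) (length-map edgeColour Es)))
      (Unique.++⁺ (AllPairs.map⁺ (TaggedMatching-colours Es tm)) uZ disjoint) sound (complete Es tm const two)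
    where
    disjoint : ∀ {i} → i ∈ map edgeColour Es × i ∈ Zs → ⊥
    disjoint (i∈ , i∈Zs) with ∈-map⁻ edgeColour i∈
    ... | a , a∈ , refl = All.lookup avoid a∈ i∈Zs
    sound : ∀ {x y} → x ∈ endpoints Es → y ∈ endpoints Es → x ≢ y → κ x y ∈ map edgeColour Es ++ Zs
    sound x∈ y∈ x≢y with TaggedMatching-colour Es t tm const x∈ y∈ x≢y
    ... | inj₁ i∈ = ∈-++⁺ˡ i∈
    ... | inj₂ i∈ = ∈-++⁺ʳ (map edgeColour Es) (tags⊆Zs i∈)
    complete : ∀ Es → TaggedMatching Es → All (λ a → proj₂ a ≡ t) Es → 2 ≤ length Es →
      ∀ {i} → i ∈ map edgeColour Es ++ Zs → AppearsIn c (_∈ endpoints Es) i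
    complete Es tm _ _ i∈ with ∈-++⁻ (map edgeColour Es) i∈
    ... | inj₁ i∈′ with ∈-map⁻ edgeColour i∈′
    ...   | a , a∈ , refl = edgeColour-appears Es tm a∈
    complete (_ ∷ []) _ _ (s≤s ()) _ | inj₂ _
    complete (a ∷ b ∷ Es) tm (_ ∷ refl ∷ _) _ i∈ | inj₂ i∈Zs = crossTag-appears a b Es tm (Zs⊆tags i∈Zs)

  triangle : ∀ x y z → x ≢ y → x ≢ z → y ≢ z → κ x y ≢ κ x z → κ x y ≢ κ y z → κ x z ≢ κ y z →
    ExactlyColours c (_∈ x ∷ y ∷ z ∷ []) 3
  triangle x y z x≢y x≢z y≢z xy≢xz xy≢yz xz≢yz =
    monochromatic+rainbow-apex x (y ∷ z ∷ []) (κ y z) x∉ ((y≢z ∷ []) ∷ [] ∷ []) ((xy≢xz ∷ []) ∷ [] ∷ []) mono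
      (xy≢yz ∷ xz≢yz ∷ []) (s≤s (s≤s z≤n))
    where
    x∉ : x ∉ y ∷ z ∷ []
    x∉ (here x≡y) = x≢y x≡y
    x∉ (there (here x≡z)) = x≢z x≡z
    mono : ∀ {u v} → u ∈ y ∷ z ∷ [] → v ∈ y ∷ z ∷ [] → u ≢ v → κ u v ≡ κ y z
    mono u∈ v∈ u≢v = ends-colour (y , z) u∈ v∈ u≢v

  two-edges-three-colours : ∀ Es t → TaggedMatching Es → All (λ a → proj₂ a ≡ t) Es →
    All (λ a → edgeColour a ∉ tagList t) Es → 2 ≤ length Es → SpansExactly 3
  two-edges-three-colours (_ ∷ []) _ _ _ _ (s≤s ())
  two-edges-three-colours (((p , q) , ta) ∷ ((p′ , q′) , _) ∷ L) (α , ζ , δ , β)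
    tm@((_ , p′≢q′ , _) , p≢q , (sep ∷ _) , ((p′p , p′q , q′p , q′q) ∷ _))
    const@(_ ∷ refl ∷ _) (a∉ ∷ b∉ ∷ _) _
    with α ≟ᶠ δ | ζ ≟ᶠ β | α ≟ᶠ ζ
  ... | no α≢δ | _ | _ =
    spans refl (triangle p p′ q′
      (≢-sym (separated-≢ sep (here refl) (here refl))) (≢-sym (separated-≢ sep (there (here refl)) (here refl))) p′≢q′
      (λ eq → α≢δ (trans (sym pp′) (trans eq pq′)))
      (λ eq → b∉ (here (trans (sym eq) pp′))) (λ eq → b∉ (there (there (here (trans (sym eq) pq′))))))
    where
    pp′ : κ p p′ ≡ α
    pp′ = trans (symm c p p′) p′p
    pq′ : κ p q′ ≡ δ
    pq′ = trans (symm c p q′) q′p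
  ... | yes _ | no ζ≢β | _ =
    spans refl (triangle q p′ q′
      (≢-sym (separated-≢ sep (here refl) (there (here refl)))) (≢-sym (separated-≢ sep (there (here refl)) (there (here refl))))
      p′≢q′ (λ eq → ζ≢β (trans (sym qp′) (trans eq qq′)))
      (λ eq → b∉ (there (here (trans (sym eq) qp′)))) (λ eq → b∉ (there (there (there (here (trans (sym eq) qq′)))))))
    where
    qp′ : κ q p′ ≡ ζ
    qp′ = trans (symm c q p′) p′q
    qq′ : κ q q′ ≡ β
    qq′ = trans (symm c q q′) q′q
  ... | yes _ | yes _ | no α≢ζ =
    spans refl (triangle p′ p q
      (separated-≢ sep (here refl) (here refl)) (separated-≢ sep (here refl) (there (here refl))) p≢q
      (λ eq → α≢ζ (trans (sym p′p) (trans eq p′q)))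
      (λ eq → a∉ (here (trans (sym eq) p′p))) (λ eq → a∉ (there (here (trans (sym eq) p′q)))))
  ... | yes α≡δ | yes ζ≡β | yes α≡ζ =
    spans refl (matching-exactly (((p , q) , ta) ∷ ((p′ , q′) , (α , ζ , δ , β)) ∷ []) (α , ζ , δ , β) (α ∷ [])
      (TaggedMatching-resp-⊆ first-two tm) (All-resp-⊆ first-two const) ([] ∷ [])
      (tagList-constant α≡ζ α≡δ (trans α≡ζ ζ≡β)) (λ { (here refl) → here refl })
      ((λ { (here refl) → a∉ (here refl) }) ∷ (λ { (here refl) → b∉ (here refl) }) ∷ []) (s≤s (s≤s z≤n)))
    where
    first-two : ((p , q) , ta) ∷ ((p′ , q′) , (α , ζ , δ , β)) ∷ []
              ⊆ ((p , q) , ta) ∷ ((p′ , q′) , (α , ζ , δ , β)) ∷ L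
    first-two = refl ∷ refl ∷ minimum L

-- A vertex of large colour degree

-- enough leaves to add s more vertices to the spine or l more to the min-coloured sequence
spineBound : ℕ → ℕ → ℕ → ℕ
spineBound NS zero l = 1
spineBound NS (suc s) zero = 1
spineBound NS (suc s) (suc l) = suc ((2 ^ NS * spineBound NS s (suc l) + NS * (NS * NS)) * suc (spineBound NS (suc s) l))

module Refinement {V : Set} {k : ℕ} (c : Colouring V k) where
  open Configurations c
  open import Data.List.Membership.DecPropositional (_≟ᶠ_ {k}) using (_∈?_)

  avoiding : ∀ (O : List (Fin k)) as ys → (∀ {a} → a ∈ as → AllPairs (_≢_ on κ a) ys) →
    ∃ λ zs → zs ⊆ ys × (∀ {u a} → u ∈ zs → a ∈ as → κ a u ∉ O) × length ys ∸ length as * length O ≤ length zs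
  avoiding O [] ys _ = ys , ⊆-refl , (λ _ ()) , ≤-refl
  avoiding O (a ∷ as) ys inj with avoiding O as ys (λ a∈ → inj (there a∈))
  ... | zs , zs⊆ , avoid , len =
    filter avoids-a? zs , ⊆-trans (filter-⊆ avoids-a? zs) zs⊆ , avoid′ , (begin
      length ys ∸ (length O + length as * length O) ≡⟨ cong (length ys ∸_) (+-comm (length O) _) ⟩
      length ys ∸ (length as * length O + length O) ≡⟨ ∸-+-assoc (length ys) (length as * length O) (length O) ⟨
      length ys ∸ length as * length O ∸ length O   ≤⟨ ∸-monoˡ-≤ (length O) len ⟩
      length zs ∸ length O
        ≤⟨ length-filter-∉ _≟ᶠ_ (κ a) O zs (AllPairs-resp-⊆ zs⊆ (inj (here refl))) ⟩
      length (filter avoids-a? zs)                  ∎)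
    where
    open ≤-Reasoning
    avoids-a? : Decidable (λ u → κ a u ∉ O)
    avoids-a? u = ¬? (κ a u ∈? O)
    avoid′ : ∀ {u b} → u ∈ filter avoids-a? zs → b ∈ a ∷ as → κ b u ∉ O
    avoid′ u∈ (here refl) = All.lookup (all-filter avoids-a? zs) u∈
    avoid′ u∈ (there b∈) = avoid (Any-resp-⊆ (filter-⊆ avoids-a? zs) u∈) b∈

  Homogeneous : V → V → List V → Set
  Homogeneous v a zs = All (λ u → κ a u ≡ κ v u) zs ⊎ All (λ u → κ a u ≢ κ v u) zs

  Homogeneous-resp-⊆ : ∀ {v a xs ys} → xs ⊆ ys → Homogeneous v a ys → Homogeneous v a xs
  Homogeneous-resp-⊆ τ (inj₁ same) = inj₁ (All-resp-⊆ τ same)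
  Homogeneous-resp-⊆ τ (inj₂ diff) = inj₂ (All-resp-⊆ τ diff)

  homogeneous : ∀ v as ys →
    ∃ λ zs → zs ⊆ ys × (∀ {a} → a ∈ as → Homogeneous v a zs) × length ys ≤ 2 ^ length as * length zs
  homogeneous v [] ys = ys , ⊆-refl , (λ ()) , ≤-reflexive (sym (+-identityʳ _))
  homogeneous v (a ∷ as) ys with larger-part (λ u → κ a u ≟ᶠ κ v u) ys
  ... | ys₁ , ys₁⊆ , hom , len₁ with homogeneous v as ys₁
  ...   | zs , zs⊆ , homs , len₂ =
    zs , ⊆-trans zs⊆ ys₁⊆ , homs′ , (begin
      length ys                         ≤⟨ len₁ ⟩
      2 * length ys₁                    ≤⟨ *-monoʳ-≤ 2 len₂ ⟩
      2 * (2 ^ length as * length zs)   ≡⟨ *-assoc 2 (2 ^ length as) _ ⟨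
      2 ^ length (a ∷ as) * length zs   ∎)
    where
    open ≤-Reasoning
    homs′ : ∀ {b} → b ∈ a ∷ as → Homogeneous v b zs
    homs′ (here refl) = Homogeneous-resp-⊆ zs⊆ hom
    homs′ (there b∈) = homs b∈

-- The leaves U of a rainbow star at apex are consumed one at a time.  The
-- current vertex either sees a large part of the remaining leaves in a single
-- colour, and joins the min-coloured sequence Ls, or it sees many of them in
-- distinct colours, and joins the spine Q after the leaves are cut down so
-- that the spine invariants hold again.
module SpineOrMinLex {V : Set} {k : ℕ} (c : Colouring V k) (apex : V) (NS NL : ℕ) where
  open Configurations c
  open Refinement c

  record Invariant (Q : List V) (Ls : List Labelled) (U : List V) : Set where
    field
      apex∉U       : apex ∉ U
      apex-inj-U   : AllPairs (_≢_ on κ apex) U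
      apex-inj-UL  : ∀ {u a} → u ∈ U → a ∈ vertices Ls → κ apex u ≢ κ apex a
      apex∉L       : apex ∉ vertices Ls
      apex-inj-L   : AllPairs (_≢_ on κ apex) (vertices Ls)
      minLex       : MinLex Ls
      labelled-U   : ∀ {u} → u ∈ U → All (λ (x , γ) → κ x u ≡ γ) Ls
      U∉Q          : ∀ {u} → u ∈ U → u ∉ Q
      spine-inj-U  : ∀ {a} → a ∈ Q → AllPairs (_≢_ on κ a) U
      fresh-U      : ∀ {u a} → u ∈ U → a ∈ Q → κ a u ∉ pairColours Q
      refines-U    : ∀ {u w} → u ∈ U → w ∈ U → Refines Q u w
      spine        : ∀ {w} → w ∈ U → Spine w Q
  open Invariant

  Invariant-resp-⊆ : ∀ {Q Ls U U′} → U′ ⊆ U → Invariant Q Ls U → Invariant Q Ls U′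
  Invariant-resp-⊆ τ I = record
    { apex∉U = λ a∈ → apex∉U I (Any-resp-⊆ τ a∈)
    ; apex-inj-U = AllPairs-resp-⊆ τ (apex-inj-U I)
    ; apex-inj-UL = λ u∈ → apex-inj-UL I (Any-resp-⊆ τ u∈)
    ; apex∉L = apex∉L I
    ; apex-inj-L = apex-inj-L I
    ; minLex = minLex I
    ; labelled-U = λ u∈ → labelled-U I (Any-resp-⊆ τ u∈)
    ; U∉Q = λ u∈ → U∉Q I (Any-resp-⊆ τ u∈)
    ; spine-inj-U = λ a∈ → AllPairs-resp-⊆ τ (spine-inj-U I a∈)
    ; fresh-U = λ u∈ → fresh-U I (Any-resp-⊆ τ u∈)
    ; refines-U = λ u∈ w∈ → refines-U I (Any-resp-⊆ τ u∈) (Any-resp-⊆ τ w∈)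
    ; spine = λ w∈ → spine I (Any-resp-⊆ τ w∈)
    }

  head∉tail : ∀ {Q Ls v U} → Invariant Q Ls (v ∷ U) → v ∉ U
  head∉tail I v∈ with apex-inj-U I
  ... | v≢ ∷ _ = All.lookup v≢ v∈ refl

  extend-minLex : ∀ {Q Ls v U ys b} → Invariant Q Ls (v ∷ U) → ys ⊆ U → All (λ y → κ v y ≡ b) ys →
    Invariant Q ((v , b) ∷ Ls) ys
  extend-minLex {Q} {Ls} {v} {U} {ys} {b} I ys⊆ const = record
    { apex∉U = apex∉U I′
    ; apex-inj-U = apex-inj-U I′
    ; U∉Q = U∉Q I′
    ; spine-inj-U = spine-inj-U I′
    ; fresh-U = fresh-U I′
    ; refines-U = refines-U I′
    ; spine = spine I′
    ; apex-inj-UL = apex-inj-UL′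
    ; apex∉L = λ { (here refl) → apex∉U I (here refl) ; (there a∈) → apex∉L I a∈ }
    ; apex-inj-L = All.tabulate (λ a∈ → apex-inj-UL I (here refl) a∈) ∷ apex-inj-L I
    ; minLex = minLex I , (λ v∈ → apex-inj-UL I (here refl) v∈ refl) , labelled-U I (here refl)
    ; labelled-U = λ u∈ → All.lookup const u∈ ∷ labelled-U I′ u∈
    }
    where
    I′ : Invariant Q Ls ys
    I′ = Invariant-resp-⊆ (v ∷ʳ ys⊆) I
    apex-inj-UL′ : ∀ {u a} → u ∈ ys → a ∈ vertices ((v , b) ∷ Ls) → κ apex u ≢ κ apex a
    apex-inj-UL′ u∈ (here refl) with apex-inj-U I
    ... | v≢ ∷ _ = λ eq → All.lookup v≢ (Any-resp-⊆ ys⊆ u∈) (sym eq)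
    apex-inj-UL′ u∈ (there a∈) = apex-inj-UL I′ u∈ a∈

  spine-injective : ∀ {Q Ls v U ys} → Invariant Q Ls (v ∷ U) → ys ⊆ U → AllPairs (_≢_ on κ v) ys →
    ∀ {a} → a ∈ v ∷ Q → AllPairs (_≢_ on κ a) ys
  spine-injective I ys⊆ inj (here refl) = inj
  spine-injective I ys⊆ inj (there a∈) = AllPairs-resp-⊆ (_ ∷ʳ ys⊆) (spine-inj-U I a∈)

  Refines-∷ : ∀ {Q v zs} → (∀ {a} → a ∈ Q → Homogeneous v a zs) → (∀ {u w} → u ∈ zs → w ∈ zs → Refines Q u w) →
    ∀ {u w} → u ∈ zs → w ∈ zs → Refines (v ∷ Q) u w
  Refines-∷ hom refines u∈ w∈ (here refl) (here refl) _ = refl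
  Refines-∷ hom refines u∈ w∈ (here refl) (there b∈) eq with hom b∈
  ... | inj₁ same = sym (All.lookup same w∈)
  ... | inj₂ diff = contradiction (sym eq) (All.lookup diff u∈)
  Refines-∷ hom refines u∈ w∈ (there a∈) (here refl) eq with hom a∈
  ... | inj₁ same = All.lookup same w∈
  ... | inj₂ diff = contradiction eq (All.lookup diff u∈)
  Refines-∷ hom refines u∈ w∈ (there a∈) (there b∈) eq = refines u∈ w∈ a∈ b∈ eq

  spine-cost : ∀ v Q → length (v ∷ Q) ≤ NS → length (v ∷ Q) * length (pairColours (v ∷ Q)) ≤ NS * (NS * NS)
  spine-cost v Q |vQ|≤NS = *-mono-≤ |vQ|≤NS (≤-trans (length-pairColours-≤ (v ∷ Q)) (*-mono-≤ |vQ|≤NS |vQ|≤NS))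

  -- freshness costs at most |Q|³ leaves, and homogeneity halves them once per spine vertex
  extend-spine : ∀ {Q Ls v U ys} R → Invariant Q Ls (v ∷ U) → ys ⊆ U → AllPairs (_≢_ on κ v) ys →
    length (v ∷ Q) ≤ NS → 2 ^ NS * R + NS * (NS * NS) ≤ length ys →
    ∃ λ zs → Invariant (v ∷ Q) Ls zs × R ≤ length zs
  extend-spine {Q} {Ls} {v} {U} {ys} R I ys⊆ inj |vQ|≤NS big
    with avoiding (pairColours (v ∷ Q)) (v ∷ Q) ys (spine-injective I ys⊆ inj)
  ... | fs , fs⊆ , avoid , len-fs with homogeneous v Q fs
  ...   | zs , zs⊆ , hom , len-zs = zs , invariant , R≤|zs|
    where
    zs⊆U : zs ⊆ U
    zs⊆U = ⊆-trans zs⊆ (⊆-trans fs⊆ ys⊆)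
    I′ : Invariant Q Ls zs
    I′ = Invariant-resp-⊆ (v ∷ʳ zs⊆U) I
    invariant : Invariant (v ∷ Q) Ls zs
    invariant = record
      { apex∉U = apex∉U I′
      ; apex-inj-U = apex-inj-U I′
      ; apex-inj-UL = apex-inj-UL I′
      ; apex∉L = apex∉L I′
      ; apex-inj-L = apex-inj-L I′
      ; minLex = minLex I′
      ; labelled-U = labelled-U I′
      ; U∉Q = λ u∈ → λ { (here refl) → head∉tail I (Any-resp-⊆ zs⊆U u∈) ; (there u∈Q) → U∉Q I′ u∈ u∈Q }
      ; spine-inj-U = λ a∈ → AllPairs-resp-⊆ (⊆-trans zs⊆ fs⊆) (spine-injective I ys⊆ inj a∈)
      ; fresh-U = λ u∈ → avoid (Any-resp-⊆ zs⊆ u∈)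
      ; refines-U = Refines-∷ hom (refines-U I′)
      ; spine = λ w∈ → let w∈U = Any-resp-⊆ zs⊆U w∈ in
          spine I′ w∈ , U∉Q I (here refl) , fresh-U I (here refl) , refines-U I (here refl) (there w∈U) ,
          refines-U I (there w∈U) (here refl)
      }
    R≤|zs| : R ≤ length zs
    R≤|zs| = *-cancelˡ-≤ (2 ^ length Q) {{m^n≢0 2 (length Q)}} (begin
      2 ^ length Q * R                               ≤⟨ *-monoˡ-≤ R (^-monoʳ-≤ 2 (≤-trans (n≤1+n _) |vQ|≤NS)) ⟩
      2 ^ NS * R                                     ≡⟨ m+n∸n≡m _ (NS * (NS * NS)) ⟨
      2 ^ NS * R + NS * (NS * NS) ∸ NS * (NS * NS)   ≤⟨ ∸-mono big (spine-cost v Q |vQ|≤NS) ⟩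
      length ys ∸ length (v ∷ Q) * length (pairColours (v ∷ Q)) ≤⟨ len-fs ⟩
      length fs                                      ≤⟨ len-zs ⟩
      2 ^ length Q * length zs                       ∎)
      where open ≤-Reasoning

  SpineOutcome : Set
  SpineOutcome = ∃ λ Q → length Q ≡ NS × ∃ λ w → Spine w Q

  MinLexOutcome : Set
  MinLexOutcome = ∃ λ Ls → length Ls ≡ NL × MinLex Ls × apex ∉ vertices Ls × AllPairs (_≢_ on κ apex) (vertices Ls)

  grow : ∀ s l Q Ls U → Invariant Q Ls U → length Q + s ≡ NS → length Ls + l ≡ NL →
    spineBound NS s l ≤ length U → SpineOutcome ⊎ MinLexOutcome
  grow zero l Q Ls (w ∷ U) I |Q|≡ _ _ = inj₁ (Q , trans (sym (+-identityʳ _)) |Q|≡ , w , spine I (here refl))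
  grow (suc s) zero Q Ls U I _ |Ls|≡ _ =
    inj₂ (Ls , trans (sym (+-identityʳ _)) |Ls|≡ , minLex I , apex∉L I , apex-inj-L I)
  grow (suc s) (suc l) Q Ls (v ∷ U) I |Q|≡ |Ls|≡ (s≤s big)
    with constant-or-injective _≟ᶠ_ (κ v) (2 ^ NS * spineBound NS s (suc l) + NS * (NS * NS)) (spineBound NS (suc s) l) U big
  ... | inj₁ (ys , ys⊆ , len , b , const) =
    grow (suc s) l Q ((v , b) ∷ Ls) ys (extend-minLex I ys⊆ const) |Q|≡ (trans (sym (+-suc _ l)) |Ls|≡)
      (≤-trans (n≤1+n _) len)
  ... | inj₂ (ys , ys⊆ , len , inj)
    with extend-spine (spineBound NS s (suc l)) I ys⊆ inj |vQ|≤NS (≤-reflexive (sym len))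
    where
    |vQ|≤NS : suc (length Q) ≤ NS
    |vQ|≤NS = subst (suc (length Q) ≤_) |Q|≡
      (subst (_≤ length Q + suc s) (+-comm (length Q) 1) (+-monoʳ-≤ (length Q) (s≤s z≤n)))
  ...   | zs , I′ , big′ = grow s (suc l) (v ∷ Q) Ls zs I′ (trans (sym (+-suc _ s)) |Q|≡) |Ls|≡ big′

  spine-or-minLex : ∀ U → apex ∉ U → AllPairs (_≢_ on κ apex) U → spineBound NS NS NL ≤ length U →
    SpineOutcome ⊎ MinLexOutcome
  spine-or-minLex U apex∉ inj big = grow NS NL [] [] U initial refl refl big
    where
    initial : Invariant [] [] U
    initial = record
      { apex∉U = apex∉ ; apex-inj-U = inj ; apex-inj-UL = λ _ () ; apex∉L = λ () ; apex-inj-L = []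
      ; minLex = tt ; labelled-U = λ _ → [] ; U∉Q = λ _ () ; spine-inj-U = λ () ; fresh-U = λ _ ()
      ; refines-U = λ _ _ () ; spine = λ _ → tt }

module StarBranch {V : Set} {k : ℕ} (c : Colouring V k) (apex : V) (n : ℕ) (3≤T : 3 ≤ n C 2) where
  open Configurations c

  T : ℕ
  T = n C 2

  open SpineOrMinLex c apex (n * suc T) (suc T * suc T)

  spine-case : SpineOutcome → SpansExactly T
  spine-case (Q , |Q|≡ , w , sp) with constant-or-injective _≟ᶠ_ (λ a → κ a w) n T Q (≤-reflexive (sym |Q|≡))
  ... | inj₂ (Y , Y⊆ , |Y|≡n , inj) = spans (cong (_C 2) |Y|≡n) (spine-rainbow w Y (Spine-resp-⊆ Y⊆ sp) inj)
  ... | inj₁ (Y , Y⊆ , len , γ , const) with take (suc T) Y | take-⊆ (suc T) Y | length-take-≤ (suc T) Y len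
  ...   | v ∷ Y′ | τ | |vY′|≡ =
    spans (suc-injective |vY′|≡) (spine-maxLex w γ v Y′ (Spine-resp-⊆ (⊆-trans τ Y⊆) sp) (All-resp-⊆ τ const))

  minLex-case : MinLexOutcome → SpansExactly T
  minLex-case (Ls , |Ls|≡ , ml , apex∉ , inj) with constant-or-injective _≟ᶠ_ proj₂ (suc T) T Ls (≤-reflexive (sym |Ls|≡))
  ... | inj₂ (e ∷ Y , Y⊆ , len , _ ∷ distinct) = spans (suc-injective len) (minLex-exactly e Y (MinLex-resp-⊆ Y⊆ ml) distinct)
  ... | inj₁ (Y , Y⊆ , len , b , const) =
    subst SpansExactly (m+[n∸m]≡n (≤-trans (s≤s z≤n) 3≤T))
      (minLex-constant+rainbow-apex apex Y b (T ∸ 1) (MinLex-resp-⊆ Y⊆ ml) const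
        (λ a∈ → apex∉ (Any-resp-⊆ (map⁺ proj₁ Y⊆) a∈)) (AllPairs-resp-⊆ (map⁺ proj₁ Y⊆) inj)
        (≤-trans (s≤s (m∸n≤m T 1)) len) (∸-monoˡ-≤ 1 3≤T))

  star-case : ∀ U → apex ∉ U → AllPairs (_≢_ on κ apex) U →
    spineBound (n * suc T) (n * suc T) (suc T * suc T) ≤ length U → SpansExactly T
  star-case U apex∉ inj big with spine-or-minLex U apex∉ inj big
  ... | inj₁ sp = spine-case sp
  ... | inj₂ ml = minLex-case ml

-- Bounded colour degree

refinementBound : ℕ → ℕ → ℕ
refinementBound D s = suc D * suc s

-- one refinement per pair of endpoints, each losing a factor D + 1
crossBound : ℕ → ℕ → ℕ
crossBound D s = refinementBound D (refinementBound D (refinementBound D (refinementBound D s)))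

taggedBound : ℕ → ℕ → ℕ
taggedBound D zero = 0
taggedBound D (suc m) = suc (crossBound D (taggedBound D m))

twoStepBound : ℕ → ℕ → ℕ
twoStepBound T s = suc T * suc (T * suc s)

matchingBound : ℕ → ℕ
matchingBound T = twoStepBound T (twoStepBound T (T + 6))

module TaggedMatchings {V : Set} (_≟_ : DecidableEquality V) {k : ℕ} (c : Colouring V k) (D : ℕ) (W : List V) where
  open Configurations c
  open import Data.List.Membership.DecPropositional _≟_ using (_∈?_)

  BoundedColourDegree : Set
  BoundedColourDegree = ∀ {x} → x ∈ W → ∀ ys → All (_∈ W) ys → AllPairs (_≢_ on κ x) ys → length ys ≤ D

  InW : Edge → Set
  InW e = All (_∈ W) (ends e)

  other : V → Edge → V
  other x (p , q) with x ≟ p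
  ... | yes _ = q
  ... | no _ = p

  other-colour : ∀ x e → x ∈ ends e → κ x (other x e) ≡ colourOf e
  other-colour x (p , q) x∈ with x ≟ p
  ... | yes refl = refl
  ... | no x≢p with x∈
  ...   | here x≡p = contradiction x≡p x≢p
  ...   | there (here refl) = symm c q p

  other-∈W : ∀ x e → InW e → other x e ∈ W
  other-∈W x (p , q) (p∈ ∷ q∈ ∷ []) with x ≟ p
  ... | yes _ = q∈
  ... | no _ = p∈

  touches? : ∀ x → Decidable (λ e → x ∈ ends e)
  touches? x e = x ∈? ends e

  record Extendable (Es : List TaggedEdge) (U : List Edge) : Set where
    field
      separated-U : AllPairs Separated U
      proper-U    : All (λ e → proj₁ e ≢ proj₂ e) U
      inW-U       : All InW U
      separated-E : ∀ {e} → e ∈ U → All (λ a → Separated (proj₁ a) e) Es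
      cross-E     : ∀ {e} → e ∈ U → All (λ (e′ , t) → CrossColours e′ e t) Es
      tagged      : TaggedMatching Es
  open Extendable

  Extendable-resp-⊆ : ∀ {Es U U′} → U′ ⊆ U → Extendable Es U → Extendable Es U′
  Extendable-resp-⊆ τ X = record
    { separated-U = AllPairs-resp-⊆ τ (separated-U X) ; proper-U = All-resp-⊆ τ (proper-U X)
    ; inW-U = All-resp-⊆ τ (inW-U X) ; separated-E = λ e∈ → separated-E X (Any-resp-⊆ τ e∈)
    ; cross-E = λ e∈ → cross-E X (Any-resp-⊆ τ e∈) ; tagged = tagged X }

  module _ (degree≤ : BoundedColourDegree) where

    length-untouched : ∀ {x} → x ∈ W → ∀ es → All InW es → AllPairs (_≢_ on colourOf) es →
      length es ∸ D ≤ length (filter (∁? (touches? x)) es)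
    length-untouched {x} x∈ es inW distinct = begin
      length es ∸ D                              ≤⟨ ∸-monoʳ-≤ (length es) touched≤ ⟩
      length es ∸ length touched                 ≡⟨ cong (_∸ length touched) (length-filter+filter-∁ (touches? x) es) ⟨
      length touched + length (filter (∁? (touches? x)) es) ∸ length touched ≡⟨ m+n∸m≡n (length touched) _ ⟩
      length (filter (∁? (touches? x)) es)       ∎
      where
      open ≤-Reasoning
      touched : List Edge
      touched = filter (touches? x) es
      touching : All (λ e → x ∈ ends e) touched
      touching = all-filter (touches? x) es
      touched≤ : length touched ≤ D
      touched≤ = subst (_≤ D) (length-map (other x) touched)
        (degree≤ x∈ (map (other x) touched)
          (All-map⁺ (All.map (other-∈W x _) (All-resp-⊆ (filter-⊆ (touches? x) es) inW)))
          (AllPairs.map⁺ (AllPairs-map-∈ (λ {e} {e′} e∈ e′∈ col≢ κ≡ →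
             col≢ (trans (sym (other-colour x e (All.lookup touching e∈)))
                         (trans κ≡ (other-colour x e′ (All.lookup touching e′∈)))))
            (AllPairs-resp-⊆ (filter-⊆ (touches? x) es) distinct))))

    untouched-by : Edge → List Edge → List Edge
    untouched-by (p , q) es = filter (∁? (touches? q)) (filter (∁? (touches? p)) es)

    untouched-by-⊆ : ∀ e es → untouched-by e es ⊆ es
    untouched-by-⊆ (p , q) es = ⊆-trans (filter-⊆ (∁? (touches? q)) _) (filter-⊆ (∁? (touches? p)) es)

    untouched-by-disjoint : ∀ e es {e′} → e′ ∈ untouched-by e es → ∀ {x} → x ∈ ends e → x ∉ ends e′
    untouched-by-disjoint (p , q) es e′∈ (here refl) =
      All.lookup (all-filter (∁? (touches? p)) es) (Any-resp-⊆ (filter-⊆ (∁? (touches? q)) _) e′∈)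
    untouched-by-disjoint (p , q) es e′∈ (there (here refl)) =
      All.lookup (all-filter (∁? (touches? q)) (filter (∁? (touches? p)) es)) e′∈

    length-untouched-by : ∀ e es → InW e → All InW es → AllPairs (_≢_ on colourOf) es →
      length es ∸ (D + D) ≤ length (untouched-by e es)
    length-untouched-by (p , q) es (p∈ ∷ q∈ ∷ []) inW distinct = begin
      length es ∸ (D + D)                              ≡⟨ ∸-+-assoc (length es) D D ⟨
      length es ∸ D ∸ D                                ≤⟨ ∸-monoˡ-≤ D (length-untouched p∈ es inW distinct) ⟩
      length (filter (∁? (touches? p)) es) ∸ D
        ≤⟨ length-untouched q∈ _ (All-resp-⊆ τ inW) (AllPairs-resp-⊆ τ distinct) ⟩
      length (untouched-by (p , q) es)                 ∎
      where
      open ≤-Reasoning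
      τ : filter (∁? (touches? p)) es ⊆ es
      τ = filter-⊆ (∁? (touches? p)) es

    -- greedily keep an edge and discard the at most 2D edges meeting it
    separated-sublist : ∀ f es → length es ≤ f → All InW es → AllPairs (_≢_ on colourOf) es →
      ∃ λ ms → ms ⊆ es × AllPairs Separated ms × length es ≤ suc (D + D) * length ms
    separated-sublist _ [] _ _ _ = [] , [] , [] , z≤n
    separated-sublist (suc f) (e ∷ es) (s≤s |es|≤f) (inW ∷ inWs) (col≢ ∷ distinct)
      with separated-sublist f (untouched-by e es) (≤-trans (length-mono-≤ (untouched-by-⊆ e es)) |es|≤f)
             (All-resp-⊆ (untouched-by-⊆ e es) inWs) (AllPairs-resp-⊆ (untouched-by-⊆ e es) distinct)
    ... | ms , ms⊆ , sep , len = e ∷ ms , refl ∷ ms⊆es , All.tabulate separated ∷ sep , (begin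
      suc (length es)                                   ≤⟨ s≤s (m≤n+m∸n (length es) (D + D)) ⟩
      suc (D + D + (length es ∸ (D + D)))
        ≤⟨ s≤s (+-monoʳ-≤ (D + D) (≤-trans (length-untouched-by e es inW inWs distinct) len)) ⟩
      suc (D + D) + suc (D + D) * length ms             ≡⟨ *-suc (suc (D + D)) (length ms) ⟨
      suc (D + D) * length (e ∷ ms)                     ∎)
      where
      open ≤-Reasoning
      ms⊆es : ms ⊆ es
      ms⊆es = ⊆-trans ms⊆ (untouched-by-⊆ e es)
      separated : ∀ {e′} → e′ ∈ ms → Separated e e′
      separated e′∈ = untouched-by-disjoint e es (Any-resp-⊆ ms⊆ e′∈) , All.lookup col≢ (Any-resp-⊆ ms⊆es e′∈)

    constant-colour-from : ∀ {x} → x ∈ W → (f : Edge → V) → ∀ s xs → All (λ e → f e ∈ W) xs →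
      suc D * suc s ≤ length xs → ∃ λ ys → ys ⊆ xs × suc s ≤ length ys × Constant (λ e → κ x (f e)) ys
    constant-colour-from {x} x∈ f s xs inW big with constant-or-injective _≟ᶠ_ (λ e → κ x (f e)) (suc D) s xs big
    ... | inj₁ const = const
    ... | inj₂ (ys , ys⊆ , |ys|≡ , inj) = contradiction
      (subst (_≤ D) (trans (length-map f ys) |ys|≡)
        (degree≤ x∈ (map f ys) (All-map⁺ (All-resp-⊆ ys⊆ inW)) (AllPairs.map⁺ inj)))
      1+n≰n

    constant-cross-colours : ∀ e → InW e → ∀ s U → All InW U → crossBound D s ≤ length U →
      ∃ λ ys → ys ⊆ U × suc s ≤ length ys × ∃ λ t → All (λ u → CrossColours e u t) ys
    constant-cross-colours (p , q) (p∈ ∷ q∈ ∷ []) s U inW big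
      with constant-colour-from p∈ proj₁ _ U (All.map All.head inW) big
    ... | ys₁ , ys₁⊆ , len₁ , t₁ , const₁
      with constant-colour-from p∈ proj₂ _ ys₁ (All-resp-⊆ ys₁⊆ (All.map (All.head ∘ All.tail) inW)) (≤-trans (n≤1+n _) len₁)
    ... | ys₂ , ys₂⊆ , len₂ , t₂ , const₂
      with constant-colour-from q∈ proj₁ _ ys₂ (All-resp-⊆ (⊆-trans ys₂⊆ ys₁⊆) (All.map All.head inW)) (≤-trans (n≤1+n _) len₂)
    ... | ys₃ , ys₃⊆ , len₃ , t₃ , const₃
      with constant-colour-from q∈ proj₂ _ ys₃ (All-resp-⊆ (⊆-trans ys₃⊆ (⊆-trans ys₂⊆ ys₁⊆)) (All.map (All.head ∘ All.tail) inW))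
             (≤-trans (n≤1+n _) len₃)
    ... | ys₄ , ys₄⊆ , len₄ , t₄ , const₄ =
      ys₄ , ⊆-trans ys₄⊆ (⊆-trans ys₃⊆ (⊆-trans ys₂⊆ ys₁⊆)) , len₄ , (t₁ , t₂ , t₃ , t₄) ,
      All.tabulate λ u∈ →
        All.lookup const₁ (Any-resp-⊆ (⊆-trans ys₄⊆ (⊆-trans ys₃⊆ ys₂⊆)) u∈) ,
        All.lookup const₂ (Any-resp-⊆ (⊆-trans ys₄⊆ ys₃⊆) u∈) ,
        All.lookup const₃ (Any-resp-⊆ ys₄⊆ u∈) ,
        All.lookup const₄ u∈

    tagged-matching : ∀ m Es U → Extendable Es U → taggedBound D m ≤ length U →
      ∃ λ Fs → TaggedMatching Fs × m + length Es ≤ length Fs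
    tagged-matching zero Es U X _ = Es , tagged X , ≤-refl
    tagged-matching (suc m) Es (e ∷ U) X (s≤s big) with inW-U X
    ... | inW ∷ inWs with constant-cross-colours e inW (taggedBound D m) U inWs big
    ...   | ys , ys⊆ , len , t , cross =
      let (Fs , tm , |Fs|≥) = tagged-matching m ((e , t) ∷ Es) ys X′ (≤-trans (n≤1+n _) len)
      in Fs , tm , subst (_≤ length Fs) (+-suc m (length Es)) |Fs|≥
      where
      X₀ : Extendable Es ys
      X₀ = Extendable-resp-⊆ (e ∷ʳ ys⊆) X
      X′ : Extendable ((e , t) ∷ Es) ys
      X′ = record
        { separated-U = separated-U X₀ ; proper-U = proper-U X₀ ; inW-U = inW-U X₀
        ; separated-E = λ e′∈ →
            All.lookup (AllPairs-head (separated-U X)) (Any-resp-⊆ ys⊆ e′∈) ∷ separated-E X₀ e′∈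
        ; cross-E = λ e′∈ → All.lookup cross e′∈ ∷ cross-E X₀ e′∈
        ; tagged = tagged X , All.head (proper-U X) , separated-E X (here refl) , cross-E X (here refl)
        }

module MatchingBranch {V : Set} {k : ℕ} (c : Colouring V k) (T : ℕ) (3≤T : 3 ≤ T) where
  open Configurations c
  open import Data.List.Membership.DecPropositional (_≟ᶠ_ {k}) using (_∈?_)

  suc[T∸1]≡T : suc (T ∸ 1) ≡ T
  suc[T∸1]≡T = m+[n∸m]≡n (≤-trans (s≤s z≤n) 3≤T)

  ∈-vertices-pLabelled⁻ : ∀ Es {x} → x ∈ vertices (pLabelled Es) → Σ TaggedEdge λ a → a ∈ Es × x ≡ pEnd a
  ∈-vertices-pLabelled⁻ (a ∷ Es) (here refl) = a , here refl , refl
  ∈-vertices-pLabelled⁻ (a ∷ Es) (there x∈) with ∈-vertices-pLabelled⁻ Es x∈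
  ... | b , b∈ , refl = b , there b∈ , refl

  -- the newest edge's q-end is the apex of a rainbow star over the older p-ends
  apex-case : ∀ e Es α → TaggedMatching (e ∷ Es) → All (λ a → z₁ a ≡ α) Es → AllPairs (_≢_ on z₂) Es →
    length Es ≡ T → SpansExactly T
  apex-case e Es α (tm , _ , sep , cross) const inj |Es|≡ =
    subst SpansExactly suc[T∸1]≡T
      (minLex-constant+rainbow-apex (qEnd e) (pLabelled Es) α (T ∸ 1) (MinLex-pLabelled Es tm) (All-map⁺ const)
        apex∉ (AllPairs.map⁺ (AllPairs.map⁺ apex-inj))
        (≤-reflexive (trans suc[T∸1]≡T (sym (trans (length-map _ Es) |Es|≡)))) (∸-monoˡ-≤ 1 3≤T))
    where
    apex∉ : qEnd e ∉ vertices (pLabelled Es)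
    apex∉ q∈ with ∈-vertices-pLabelled⁻ Es q∈
    ... | a , a∈ , q≡p = separated-≢ (All.lookup sep a∈) (here refl) (there (here refl)) (sym q≡p)
    z₂≡ : ∀ {a} → a ∈ Es → κ (qEnd e) (pEnd a) ≡ z₂ a
    z₂≡ {a} a∈ = trans (symm c (qEnd e) (pEnd a)) (proj₁ (proj₂ (All.lookup cross a∈)))
    apex-inj : AllPairs (λ a b → κ (qEnd e) (pEnd a) ≢ κ (qEnd e) (pEnd b)) Es
    apex-inj = AllPairs-map-∈ (λ a∈ b∈ z≢ κ≡ → z≢ (trans (sym (z₂≡ a∈)) (trans κ≡ (z₂≡ b∈)))) inj

  constant-z₁z₂ : ∀ s Es → TaggedMatching Es → twoStepBound T s ≤ length Es →
    SpansExactly T ⊎ (∃ λ Ys → Ys ⊆ Es × suc s ≤ length Ys × Constant z₁ Ys × Constant z₂ Ys)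
  constant-z₁z₂ s Es tm big with constant-or-injective _≟ᶠ_ z₁ (suc T) (T * suc s) Es big
  ... | inj₂ (e ∷ Y , Y⊆ , len , _ ∷ distinct) =
    inj₁ (spans (trans (length-map _ Y) (suc-injective len))
      (minLex-exactly (pEnd e , z₁ e) (pLabelled Y) (MinLex-pLabelled (e ∷ Y) (TaggedMatching-resp-⊆ Y⊆ tm))
        (AllPairs.map⁺ distinct)))
  ... | inj₁ (e ∷ Y , Y⊆ , len , α , _ ∷ const₁) with constant-or-injective _≟ᶠ_ z₂ T s Y (≤-pred len)
  ...   | inj₂ (Z , Z⊆ , |Z|≡ , inj) =
    inj₁ (apex-case e Z α (TaggedMatching-resp-⊆ {Es = e ∷ Y} (refl ∷ Z⊆) (TaggedMatching-resp-⊆ Y⊆ tm))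
      (All-resp-⊆ Z⊆ const₁) inj |Z|≡)
  ...   | inj₁ (Z , Z⊆ , len′ , ζ , const₂) =
    inj₂ (Z , ⊆-trans Z⊆ (⊆-trans (e ∷ʳ ⊆-refl) Y⊆) , len′ , (α , All-resp-⊆ Z⊆ const₁) , (ζ , const₂))

  tagAvoiding : CrossTags → List TaggedEdge → List TaggedEdge
  tagAvoiding t = filter (λ a → ¬? (edgeColour a ∈? tagList t))

  tagAvoiding-⊆ : ∀ t Es → tagAvoiding t Es ⊆ Es
  tagAvoiding-⊆ t = filter-⊆ (λ a → ¬? (edgeColour a ∈? tagList t))

  tagAvoiding-avoids : ∀ t Es → All (λ a → edgeColour a ∉ tagList t) (tagAvoiding t Es)
  tagAvoiding-avoids t = all-filter (λ a → ¬? (edgeColour a ∈? tagList t))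

  length-tagAvoiding : ∀ Es t → TaggedMatching Es → suc (T + 6) ≤ length Es → T + 3 ≤ length (tagAvoiding t Es)
  length-tagAvoiding Es t tm big = begin
    T + 3                       ≡⟨ +-∸-assoc T {6} {3} (s≤s (s≤s (s≤s z≤n))) ⟨
    suc (T + 6) ∸ 4             ≤⟨ ∸-monoˡ-≤ 4 big ⟩
    length Es ∸ 4               ≤⟨ length-filter-∉ _≟ᶠ_ edgeColour (tagList t) Es (TaggedMatching-colours Es tm) ⟩
    length (tagAvoiding t Es)   ∎
    where open ≤-Reasoning

  -- n C 2 is 3 or at least 6; with at least six colours to hit, the four cross
  -- colours leave room for at least two edges
  constant-tags-case : T ≡ 3 ⊎ 6 ≤ T → ∀ Es t → TaggedMatching Es → All (λ a → proj₂ a ≡ t) Es →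
    suc (T + 6) ≤ length Es → SpansExactly T
  constant-tags-case (inj₁ T≡3) Es t tm const big =
    subst SpansExactly (sym T≡3)
      (two-edges-three-colours (tagAvoiding t Es) t (TaggedMatching-resp-⊆ (tagAvoiding-⊆ t Es) tm)
        (All-resp-⊆ (tagAvoiding-⊆ t Es) const) (tagAvoiding-avoids t Es)
        (≤-trans (s≤s (s≤s z≤n)) (≤-trans (m≤n+m 3 T) (length-tagAvoiding Es t tm big))))
  constant-tags-case (inj₂ 6≤T) Es t tm const big =
    spans (trans (cong (_+ length Zs) |Gs|≡) (m∸n+n≡m |Zs|≤T))
      (matching-exactly Gs t Zs (TaggedMatching-resp-⊆ Gs⊆ tm) (All-resp-⊆ Gs⊆ const) (deduplicate-! _≟ᶠ_ (tagList t))
        (∈-deduplicate⁺ _≟ᶠ_) (∈-deduplicate⁻ _≟ᶠ_ (tagList t))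
        (All.map (λ ∉tags ∈Zs → ∉tags (∈-deduplicate⁻ _≟ᶠ_ (tagList t) ∈Zs))
          (All-resp-⊆ (take-⊆ s (tagAvoiding t Es)) (tagAvoiding-avoids t Es)))
        (≤-trans (∸-mono 6≤T (length-deduplicate _≟ᶠ_ (tagList t))) (≤-reflexive (sym |Gs|≡))))
    where
    Zs : List (Fin k)
    Zs = deduplicate _≟ᶠ_ (tagList t)
    |Zs|≤T : length Zs ≤ T
    |Zs|≤T = ≤-trans (length-deduplicate _≟ᶠ_ (tagList t)) (≤-trans (s≤s (s≤s (s≤s (s≤s z≤n)))) 6≤T)
    s : ℕ
    s = T ∸ length Zs
    Gs : List TaggedEdge
    Gs = take s (tagAvoiding t Es)
    Gs⊆ : Gs ⊆ Es
    Gs⊆ = ⊆-trans (take-⊆ s (tagAvoiding t Es)) (tagAvoiding-⊆ t Es)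
    |Gs|≡ : length Gs ≡ s
    |Gs|≡ = length-take-≤ s (tagAvoiding t Es)
      (≤-trans (m∸n≤m T (length Zs)) (≤-trans (m≤m+n T 3) (length-tagAvoiding Es t tm big)))

  -- the second pass runs on the flipped edges, where z₁ and z₂ are the old z₄ and z₃
  matching-case : T ≡ 3 ⊎ 6 ≤ T → ∀ Es → TaggedMatching Es → matchingBound T ≤ length Es → SpansExactly T
  matching-case T-cases Es tm big with constant-z₁z₂ (twoStepBound T (T + 6)) Es tm big
  ... | inj₁ done = done
  ... | inj₂ (Ys , Ys⊆ , lenY , (α , const₁) , (ζ , const₂))
    with constant-z₁z₂ (T + 6) (map flip Ys) flipped (≤-trans (n≤1+n _) (subst (_ ≤_) (sym (length-map flip Ys)) lenY))
    where flipped = TaggedMatching-flip Ys (TaggedMatching-resp-⊆ Ys⊆ tm)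
  ...   | inj₁ done = done
  ...   | inj₂ (Zs , Zs⊆ , lenZ , (β , const₄) , (δ , const₃)) =
    constant-tags-case T-cases Zs (β , δ , ζ , α)
      (TaggedMatching-resp-⊆ Zs⊆ (TaggedMatching-flip Ys (TaggedMatching-resp-⊆ Ys⊆ tm)))
      (All.tabulate tags) lenZ
    where
    tags : ∀ {a} → a ∈ Zs → proj₂ a ≡ (β , δ , ζ , α)
    tags a∈ with ∈-map⁻ flip (Any-resp-⊆ Zs⊆ a∈)
    ... | b , b∈ , refl = cong₂ _,_ (All.lookup const₄ a∈)
      (cong₂ _,_ (All.lookup const₃ a∈) (cong₂ _,_ (All.lookup const₂ b∈) (All.lookup const₁ b∈)))

Countable⇒DecidableEquality : ∀ {V : Set} → Countable V → DecidableEquality V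
Countable⇒DecidableEquality (f , f-inj) x y with f x ≟ℕ f y
... | yes fx≡fy = yes (f-inj fx≡fy)
... | no fx≢fy = no λ x≡y → fx≢fy (cong f x≡y)

[1+n]C2≡n+nC2 : ∀ n → suc n C 2 ≡ n + n C 2
[1+n]C2≡n+nC2 n = trans (sym (nCk+nC[k+1]≡[n+1]C[k+1] n 1)) (cong (_+ n C 2) (nC1≡n n))

6≤[4+m]C2 : ∀ m → 6 ≤ (4 + m) C 2
6≤[4+m]C2 zero = ≤-refl
6≤[4+m]C2 (suc m) = ≤-trans (6≤[4+m]C2 m) (≤-trans (m≤n+m _ (4 + m)) (≤-reflexive (sym ([1+n]C2≡n+nC2 (4 + m)))))

[3+m]C2≡3⊎6≤ : ∀ m → (3 + m) C 2 ≡ 3 ⊎ 6 ≤ (3 + m) C 2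
[3+m]C2≡3⊎6≤ zero = inj₁ refl
[3+m]C2≡3⊎6≤ (suc m) = inj₂ (6≤[4+m]C2 m)

3≤[3+m]C2 : ∀ m → 3 ≤ (3 + m) C 2
3≤[3+m]C2 zero = ≤-refl
3≤[3+m]C2 (suc m) = ≤-trans (s≤s (s≤s (s≤s z≤n))) (6≤[4+m]C2 m)

starBound : ℕ → ℕ
starBound n = spineBound (n * suc (n C 2)) (n * suc (n C 2)) (suc (n C 2) * suc (n C 2))

-- opaque: unfolding these bounds during conversion checking is prohibitively expensive
opaque
  C₁ : ℕ → ℕ
  C₁ n = suc (suc (starBound n + starBound n) * taggedBound (starBound n) (matchingBound (n C 2)))

  0<C₁ : ∀ n → 0 < C₁ n
  0<C₁ n = s≤s z≤n

  C₁-bound : ∀ n {k m} → C₁ n ≤ k → k ≤ suc (starBound n + starBound n) * m →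
    taggedBound (starBound n) (matchingBound (n C 2)) ≤ m
  C₁-bound n {k} {m} C₁≤k k≤ =
    <⇒≤ (*-cancelˡ-< (suc (starBound n + starBound n)) (taggedBound (starBound n) (matchingBound (n C 2))) m
      (≤-trans C₁≤k k≤))

module ManyColours {V : Set} (_≟_ : DecidableEquality V) {k : ℕ} (c : Colouring V k) (uses : UsesAll c)
  (n : ℕ) (3≤T : 3 ≤ n C 2) (T-cases : n C 2 ≡ 3 ⊎ 6 ≤ n C 2) (C₁≤k : C₁ n ≤ k) where
  open Configurations c
  open import Data.List.Membership.DecPropositional (_≟ᶠ_ {k}) using (_∈?_)

  T D : ℕ
  T = n C 2
  D = starBound n

  representative : Fin k → Edge
  representative i = proj₁ (uses i) , proj₁ (proj₂ (uses i))

  rainbow : List Edge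
  rainbow = tabulate representative

  W : List V
  W = concatMap ends rainbow

  -- one vertex of W for each colour seen from x inside W
  colourClasses : V → List V
  colourClasses x = deduplicate (λ a b → κ x a ≟ᶠ κ x b) W

  colourClasses-injective : ∀ x → AllPairs (_≢_ on κ x) (colourClasses x)
  colourClasses-injective x = DecSetoid.deduplicate-! (On.decSetoid (Fin.≡-decSetoid k) (κ x)) W

  colourClasses-complete : ∀ x {y} → y ∈ W → κ x y ∈ map (κ x) (colourClasses x)
  colourClasses-complete x y∈ =
    Any.map⁺ (Any.deduplicate⁺ _ (λ κb≡κa κy≡κa → trans κy≡κa (sym κb≡κa)) (Any.map (cong (κ x)) y∈))

  large-colour-degree : ∀ x → suc D ≤ length (colourClasses x) → SpansExactly T
  large-colour-degree x big = StarBranch.star-case c x n 3≤T U x∉U (AllPairs-resp-⊆ (filter-⊆ new? _) (colourClasses-injective x))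
    (≤-trans (∸-monoˡ-≤ 1 big) (length-filter-∉ _≟ᶠ_ (κ x) (κ x x ∷ []) (colourClasses x) (colourClasses-injective x)))
    where
    new? : Decidable (λ v → κ x v ∉ κ x x ∷ [])
    new? v = ¬? (κ x v ∈? (κ x x ∷ []))
    U : List V
    U = filter new? (colourClasses x)
    x∉U : x ∉ U
    x∉U x∈ = All.lookup (all-filter new? (colourClasses x)) x∈ (here refl)

  open TaggedMatchings _≟_ c D W

  colour-representative : ∀ i → colourOf (representative i) ≡ i
  colour-representative i = proj₂ (proj₂ (proj₂ (uses i)))

  rainbow-distinct : AllPairs (_≢_ on colourOf) rainbow
  rainbow-distinct = AllPairs.tabulate⁺ λ {i} {j} i≢j eq →
    i≢j (trans (sym (colour-representative i)) (trans eq (colour-representative j)))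

  rainbow-inW : All InW rainbow
  rainbow-inW = All.tabulate λ e∈ → All.tabulate λ x∈ → ∈-concatMap⁺ ends (Any.map (λ { refl → x∈ }) e∈)

  rainbow-proper : All (λ e → proj₁ e ≢ proj₂ e) rainbow
  rainbow-proper = All-tabulate⁺ λ i → proj₁ (proj₂ (proj₂ (uses i)))

  bounded-degree : (∀ {x} → x ∈ W → length (colourClasses x) ≤ D) → BoundedColourDegree
  bounded-degree few {x} x∈ ys inW inj = begin
    length ys                              ≡⟨ length-map (κ x) ys ⟨
    length (map (κ x) ys)
      ≤⟨ Unique-length-≤ _≟ᶠ_ (map (κ x) (colourClasses x)) (AllPairs.map⁺ inj) seen ⟩
    length (map (κ x) (colourClasses x))   ≡⟨ length-map (κ x) (colourClasses x) ⟩
    length (colourClasses x)               ≤⟨ few x∈ ⟩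
    D                                      ∎
    where
    open ≤-Reasoning
    seen : ∀ {i} → i ∈ map (κ x) ys → i ∈ map (κ x) (colourClasses x)
    seen i∈ with ∈-map⁻ (κ x) i∈
    ... | y , y∈ , refl = colourClasses-complete x (All.lookup inW y∈)

  bounded-colour-degree : (∀ {x} → x ∈ W → length (colourClasses x) ≤ D) → SpansExactly T
  bounded-colour-degree few with separated-sublist (bounded-degree few) k rainbow (≤-reflexive (length-tabulate representative))
                            rainbow-inW rainbow-distinct
  ... | ms , ms⊆ , separated , k≤ with tagged-matching (bounded-degree few) (matchingBound T) [] ms extendable big
    where
    extendable : Extendable [] ms
    extendable = record
      { separated-U = separated ; proper-U = All-resp-⊆ ms⊆ rainbow-proper ; inW-U = All-resp-⊆ ms⊆ rainbow-inW
      ; separated-E = λ _ → [] ; cross-E = λ _ → [] ; tagged = _ }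
    big : taggedBound D (matchingBound T) ≤ length ms
    big = C₁-bound n C₁≤k (subst (_≤ suc (D + D) * length ms) (length-tabulate representative) k≤)
  ...   | Fs , tm , len = MatchingBranch.matching-case c T 3≤T T-cases Fs tm (subst (_≤ length Fs) (+-identityʳ _) len)

  spans-T : SpansExactly T
  spans-T with any? (λ x → suc D ≤? length (colourClasses x)) W
  ... | yes some = large-colour-degree (proj₁ (satisfied some)) (proj₂ (satisfied some))
  ... | no none = bounded-colour-degree λ x∈ → ≤-pred (≰⇒> (All.lookup (¬Any⇒All¬ W none) x∈))

spans-choose-2 : ∀ {V : Set} → DecidableEquality V → ∀ n {k} → C₁ n ≤ k → (c : Colouring V k) → UsesAll c →
  Configurations.SpansExactly c (n C 2)
spans-choose-2 _ 0 _ c _ = _ , Configurations.no-edge c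
spans-choose-2 _ 1 _ c _ = _ , Configurations.no-edge c
spans-choose-2 _ 2 C₁≤k c uses =
  _ , Configurations.single-edge c (proj₁ (proj₂ (proj₂ (uses (fromℕ< (≤-trans (0<C₁ 2) C₁≤k))))))
spans-choose-2 _≟_ (suc (suc (suc m))) C₁≤k c uses =
  ManyColours.spans-T _≟_ c uses (3 + m) (3≤[3+m]C2 m) ([3+m]C2≡3⊎6≤ m) C₁≤k

corollary8 : (V : Set) → Countable V →
    (n : ℕ) → Σ ℕ λ C₁ → ∀ k → k ≥ C₁ → F V k (n C 2)
corollary8 V countable n = C₁ n , λ k C₁≤k → spans-choose-2 (Countable⇒DecidableEquality countable) n C₁≤k
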